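{- Let $N>1$ be an integer divisible by some prime $p\ge5$ and by some prime $p<5$. Write $N=N_1N_2$, where $N_1$ has no prime factor $\ge5$ and $N_2$ has no prime factor $<5$. Let $G_a\subseteq GL_2(\mathbb{Z}/N\mathbb{Z})$ be a subgroup with \[ G_a\cap SL_2(\mathbb{Z}/N\mathbb{Z}) = (GL_2(\mathbb{Z}/N\mathbb{Z}))', \] the commutator subgroup of $GL_2(\mathbb{Z}/N\mathbb{Z})$. Let $G_b\subseteq G_a$ be a subgroup such that the natural reduction maps $G_b\to GL_2(\mathbb{Z}/N_1\mathbb{Z})$ and $G_b\to GL_2(\mathbb{Z}/N_2\mathbb{Z})$ are surjective and $\det: G_b\to(\mathbb{Z}/N\mathbb{Z})^*$ is surjective. Then $G_b=G_a$. -}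

module Defs where

open import Data.Nat using (ℕ; suc; _+_; _*_; _∸_; _%_; NonZero)
open import Data.Nat.DivMod using (m%n<n)
open import Data.Fin using (Fin; toℕ; fromℕ<)
open import Data.Product using (Σ; _×_)
open import Relation.Binary.PropositionalEquality using (_≡_)

-- Z/NZ is represented by Fin N (canonical residues 0..N-1).
module _ (N : ℕ) .{{_ : NonZero N}} where

  fin : ℕ → Fin N
  fin m = fromℕ< (m%n<n m N)

  zeroN oneN : Fin N
  zeroN = fin 0
  oneN  = fin 1

  addN mulN : Fin N → Fin N → Fin N
  addN x y = fin (toℕ x + toℕ y)
  mulN x y = fin (toℕ x * toℕ y)

  negN : Fin N → Fin N
  negN x = fin (N ∸ toℕ x)

  IsUnit : Fin N → Set
  IsUnit x = Σ (Fin N) λ y → mulN x y ≡ oneN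

record Mat (N : ℕ) : Set where
  constructor mat
  field
    a b c d : Fin N

module _ {N : ℕ} .{{_ : NonZero N}} where

  I₂ : Mat N
  I₂ = mat (oneN N) (zeroN N) (zeroN N) (oneN N)

  _·_ : Mat N → Mat N → Mat N
  mat a b c d · mat a' b' c' d' =
    mat (addN N (mulN N a a') (mulN N b c')) (addN N (mulN N a b') (mulN N b d'))
        (addN N (mulN N c a') (mulN N d c')) (addN N (mulN N c b') (mulN N d d'))

  det : Mat N → Fin N
  det (mat a b c d) = addN N (mulN N a d) (negN N (mulN N b c))

  GL2 : Mat N → Set
  GL2 M = IsUnit N (det M)

  SL2 : Mat N → Set
  SL2 M = det M ≡ oneN N

  record IsSubgroup (H : Mat N → Set) : Set where
    field
      ⊆GL   : ∀ M → H M → GL2 M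
      has-I : H I₂
      ·-closed : ∀ M M' → H M → H M' → H (M · M')
      inv-closed : ∀ M → H M → Σ (Mat N) λ M' → H M' × (M · M' ≡ I₂)

  -- commutator subgroup (GL_2(Z/NZ))' : generated by commutators g h g⁻¹ h⁻¹
  -- (inverse of a commutator is a commutator, so closure under I and products suffices)
  data Comm : Mat N → Set where
    comm : ∀ g g' h h' → g · g' ≡ I₂ → h · h' ≡ I₂ → Comm (((g · h) · g') · h')
    comm-I : Comm I₂
    comm-· : ∀ M M' → Comm M → Comm M' → Comm (M · M')

reduce : ∀ {N} (M : ℕ) .{{_ : NonZero M}} → Mat N → Mat M
reduce M (mat a b c d) = mat (fin M (toℕ a)) (fin M (toℕ b)) (fin M (toℕ c)) (fin M (toℕ d))

{-# OPTIONS --safe #-}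
module Submission where

-- Write GL₂ for GL₂(ℤ/N) and G for Gb.  Given M ∈ Ga, pick g ∈ G with det g = det M;
-- then g⁻¹M ∈ Ga ∩ SL₂ = [GL₂, GL₂], so it suffices that G contains every commutator
-- [g, h].  Lifting g, h modulo N₁ to a, b ∈ G, the commutator [a, b] ∈ G agrees with
-- [g, h] modulo N₁ and both have determinant 1, so it suffices that G contains the
-- kernel K of SL₂(ℤ/N) → SL₂(ℤ/N₁), i.e. (by the Chinese remainder theorem) that
-- G ∩ K maps onto SL₂(ℤ/N₂).  As SL₂(ℤ/N₂) is generated by the elementary matrices
-- E₁₂(1), E₂₁(1), it is enough to realise these: take g ∈ G reducing to E modulo N₂.
-- Since N₁ has only the prime factors 2 and 3, GL₂(ℤ/N₁) has exponent dividing some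
-- 24ᵉ (GL₂(𝔽₂) and GL₂(𝔽₃) have exponent dividing 24, and each further prime factor
-- is absorbed by one more power of 24), while 24ᵉ is invertible modulo N₂.  So for
-- 24ᵉ j ≡ 1 (mod N₂), g^(24ᵉ j) is trivial modulo N₁ and equals E^(24ᵉ j) = E modulo N₂.

open import Data.Fin using (Fin; toℕ)
import Data.Fin.Properties as Fin
open import Data.Integer as ℤ using (ℤ; +_; 0ℤ; 1ℤ; _+_; _-_; _*_; -_; _%ℕ_)
open import Data.Integer.DivMod using (a≡a%ℕn+[a/ℕn]*n; n%ℕd<d)
import Data.Integer.Coprimality as ℤCoprime
open import Data.Integer.Divisibility.Signed
  using (_∣_; divides; _∣?_; ∣ᵤ⇒∣; ∣⇒∣ᵤ; ∣-trans; ∣m∣n⇒∣m+n; ∣m⇒∣-m; ∣m⇒∣m*n; ∣n⇒∣m*n)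
import Data.Integer.Properties as ℤ
open import Data.Integer.Tactic.RingSolver using (solve-∀)
open import Data.List using ([]; _∷_)
open import Data.List.Relation.Unary.All using (All; []; _∷_)
open import Data.Nat as ℕ using (ℕ; zero; suc; NonZero; s≤s; _^_)
open import Data.Nat.Coprimality using (Coprime)
import Data.Nat.Coprimality as ℕCoprime
import Data.Nat.Divisibility as ℕ
import Data.Nat.DivMod as ℕ
open import Data.Nat.GCD using (module Bézout)
open import Data.Nat.ListAction using (product)
open import Data.Nat.Primality
  using (Prime; ¬prime[1]; composite⇒¬prime; composite[4]; prime⇒irreducible; euclidsLemma)
open import Data.Nat.Primality.Factorisation using (PrimeFactorisation; factorise)
import Data.Nat.Properties as ℕ
open import Data.Nat.Properties using (allUpTo?)
open import Data.Product using (Σ; _×_; _,_; ∃-syntax; proj₁; proj₂)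
open import Data.Sum using (_⊎_; inj₁; inj₂)
open import Function using (_$_)
open import Relation.Binary.Bundles using (Setoid)
open import Relation.Binary.PropositionalEquality
import Relation.Binary.Reasoning.Setoid as SetoidReasoning
open import Relation.Nullary.Decidable using (Dec; yes; no; map′; _×-dec_; _⊎-dec_; toWitness)
open import Relation.Nullary.Negation using (¬_; contradiction)

open import Defs

-- Congruences of integers

private variable
  x y z : ℤ
  m n : ℕ

infix 4 _≡_mod_
record _≡_mod_ (x y : ℤ) (n : ℕ) : Set where
  constructor from-∣
  field to-∣ : + n ∣ x - y
open _≡_mod_

≡-mod-reflexive : ∀ {x y n} → x ≡ y → x ≡ y mod n
≡-mod-reflexive {x} {n = n} refl = from-∣ $ divides 0ℤ (trans (ℤ.+-inverseʳ x) (sym (ℤ.*-zeroˡ (+ n))))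

≡-mod-refl : x ≡ x mod n
≡-mod-refl = ≡-mod-reflexive refl

≡-mod-sym : ∀ {x y n} → x ≡ y mod n → y ≡ x mod n
≡-mod-sym {x} {y} (from-∣ p) = from-∣ $ subst (_ ∣_) (negate-minus x y) (∣m⇒∣-m p)
  where
  negate-minus : ∀ x y → - (x - y) ≡ y - x
  negate-minus = solve-∀

≡-mod-trans : ∀ {x y z n} → x ≡ y mod n → y ≡ z mod n → x ≡ z mod n
≡-mod-trans {x} {y} {z} (from-∣ p) (from-∣ q) = from-∣ $ subst (_ ∣_) (ℤ.+-minus-telescope x y z) (∣m∣n⇒∣m+n p q)

≡-mod-setoid : ℕ → Setoid _ _
≡-mod-setoid n = record
  { Carrier = ℤ
  ; _≈_ = λ x y → x ≡ y mod n
  ; isEquivalence = record { refl = ≡-mod-refl ; sym = ≡-mod-sym ; trans = ≡-mod-trans }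
  }

+-cong-mod : ∀ {x x′ y y′ n} → x ≡ x′ mod n → y ≡ y′ mod n → x + y ≡ x′ + y′ mod n
+-cong-mod {x} {x′} {y} {y′} (from-∣ p) (from-∣ q) = from-∣ $ subst (_ ∣_) (regroup x x′ y y′) (∣m∣n⇒∣m+n p q)
  where
  regroup : ∀ x x′ y y′ → (x - x′) + (y - y′) ≡ (x + y) - (x′ + y′)
  regroup = solve-∀

*-cong-mod : ∀ {x x′ y y′ n} → x ≡ x′ mod n → y ≡ y′ mod n → x * y ≡ x′ * y′ mod n
*-cong-mod {x} {x′} {y} {y′} (from-∣ p) (from-∣ q) =
  from-∣ $ subst (_ ∣_) (regroup x x′ y y′) (∣m∣n⇒∣m+n (∣m⇒∣m*n y p) (∣n⇒∣m*n x′ q))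
  where
  regroup : ∀ x x′ y y′ → (x - x′) * y + x′ * (y - y′) ≡ x * y - x′ * y′
  regroup = solve-∀

+-congˡ-mod : ∀ z → x ≡ y mod n → z + x ≡ z + y mod n
+-congˡ-mod z = +-cong-mod (≡-mod-refl {x = z})

+-congʳ-mod : ∀ z → x ≡ y mod n → x + z ≡ y + z mod n
+-congʳ-mod z x≡y = +-cong-mod x≡y (≡-mod-refl {x = z})

*-congˡ-mod : ∀ z → x ≡ y mod n → z * x ≡ z * y mod n
*-congˡ-mod z = *-cong-mod (≡-mod-refl {x = z})

*-congʳ-mod : ∀ z → x ≡ y mod n → x * z ≡ y * z mod n
*-congʳ-mod z x≡y = *-cong-mod x≡y (≡-mod-refl {x = z})

neg-cong-mod : ∀ {x x′ n} → x ≡ x′ mod n → - x ≡ - x′ mod n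
neg-cong-mod {x} {x′} (from-∣ p) = from-∣ $ subst (_ ∣_) (regroup x x′) (∣m⇒∣-m p)
  where
  regroup : ∀ x x′ → - (x - x′) ≡ - x - - x′
  regroup = solve-∀

≡-mod-∣ : m ℕ.∣ n → x ≡ y mod n → x ≡ y mod m
≡-mod-∣ m∣n (from-∣ p) = from-∣ $ ∣-trans (∣ᵤ⇒∣ m∣n) p

≡-mod-1 : ∀ {x y} → x ≡ y mod 1
≡-mod-1 {x} {y} = from-∣ $ divides (x - y) (sym (ℤ.*-identityʳ (x - y)))

x+kn≡x-mod : ∀ {n} x k → x + k * + n ≡ x mod n
x+kn≡x-mod {n} x k = from-∣ $ divides k (x+y-x x (k * + n))
  where
  x+y-x : ∀ x y → x + y - x ≡ y
  x+y-x = solve-∀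

%ℕ-≡-mod : .{{_ : NonZero n}} → ∀ x → + (x %ℕ n) ≡ x mod n
%ℕ-≡-mod {n} x = ≡-mod-sym (≡-mod-trans (≡-mod-reflexive (a≡a%ℕn+[a/ℕn]*n x n)) (x+kn≡x-mod (+ (x %ℕ n)) (x ℤ./ℕ n)))

∣⇒≡0-mod : ∀ {n k} → n ℕ.∣ k → + k ≡ 0ℤ mod n
∣⇒≡0-mod {n} {k} n∣k = from-∣ (subst (+ n ∣_) (sym (ℤ.+-identityʳ (+ k))) (∣ᵤ⇒∣ {+ n} {+ k} n∣k))

≡0⇒+*≡-mod : z ≡ 0ℤ mod n → ∀ x y → x + z * y ≡ x mod n
≡0⇒+*≡-mod z≡0 x y = ≡-mod-trans (+-congˡ-mod x (*-congʳ-mod y z≡0))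
  (≡-mod-reflexive (trans (cong (_+_ x) (ℤ.*-zeroˡ y)) (ℤ.+-identityʳ x)))

≡-mod-coprime-* : ∀ {x y m n} → Coprime m n → x ≡ y mod m → x ≡ y mod n → x ≡ y mod (m ℕ.* n)
≡-mod-coprime-* {x} {y} {m} {n} m⊥n (from-∣ (divides q eq)) (from-∣ n∣x-y) = from-∣ $ divides r (begin
    x - y            ≡⟨ eq ⟩
    q * + m          ≡⟨ cong (_* + m) eqr ⟩
    r * + n * + m    ≡⟨ reassoc r (+ n) (+ m) ⟩
    r * (+ m * + n)  ≡⟨ cong (r *_) (ℤ.pos-* m n) ⟨
    r * + (m ℕ.* n)  ∎)
  where
  open ≡-Reasoning
  reassoc : ∀ r n m → r * n * m ≡ r * (m * n)
  reassoc = solve-∀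
  n∣q : + n ∣ q
  n∣q = ∣ᵤ⇒∣ (ℤCoprime.coprime-divisor (+ n) (+ m) q (ℕCoprime.sym m⊥n)
    (∣⇒∣ᵤ (subst (+ n ∣_) (trans eq (ℤ.*-comm q (+ m))) n∣x-y)))
  r : ℤ
  r = _∣_.quotient n∣q
  eqr : q ≡ r * + n
  eqr = _∣_.equality n∣q

≡-mod⇒≡ : ∀ {m k n} .{{_ : NonZero n}} → m ℕ.< n → k ℕ.< n → + m ≡ + k mod n → m ≡ k
≡-mod⇒≡ {m} {k} {n} m<n k<n (from-∣ n∣m-k) =
  ℤ.+-injective (ℤ.i-j≡0⇒i≡j (+ m) (+ k) (ℤ.∣i∣≡0⇒i≡0 ∣m-k∣≡0))
  where
  ∣m-k∣<n : ℤ.∣ + m - + k ∣ ℕ.< n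
  ∣m-k∣<n = ℕ.≤-<-trans (ℕ.≤-reflexive (cong ℤ.∣_∣ (ℤ.m-n≡m⊖n m k))) (ℕ.≤-<-trans (ℤ.∣m⊝n∣≤m⊔n m k) (ℕ.⊔-pres-<m m<n k<n))
  ∣m-k∣≡0 : ℤ.∣ + m - + k ∣ ≡ 0
  ∣m-k∣≡0 = trans (sym (ℕ.m<n⇒m%n≡m ∣m-k∣<n)) (ℕ.n∣m⇒m%n≡0 _ n (∣⇒∣ᵤ n∣m-k))

pos-divMod : ∀ x y .{{_ : NonZero y}} → + (x ℕ.% y) + + (x ℕ./ y) * + y ≡ + x
pos-divMod x y = begin
  + (x ℕ.% y) + + (x ℕ./ y) * + y     ≡⟨ cong (_+_ (+ (x ℕ.% y))) (ℤ.pos-* (x ℕ./ y) y) ⟨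
  + (x ℕ.% y) + + (x ℕ./ y ℕ.* y)    ≡⟨ ℤ.pos-+ (x ℕ.% y) (x ℕ./ y ℕ.* y) ⟨
  + (x ℕ.% y ℕ.+ x ℕ./ y ℕ.* y)      ≡⟨ cong +_ (ℕ.m≡m%n+[m/n]*n x y) ⟨
  + x                                ∎
  where open ≡-Reasoning

infix 4 _≡?_mod_
_≡?_mod_ : ∀ x y n → Dec (x ≡ y mod n)
x ≡? y mod n = map′ from-∣ to-∣ (+ n ∣? x - y)

1≡0-mod⇒≡1 : 1ℤ ≡ 0ℤ mod n → n ≡ 1
1≡0-mod⇒≡1 (from-∣ n∣1) = ℕ.∣1⇒≡1 (∣⇒∣ᵤ n∣1)

inverse-mod : ∀ {k n} → Coprime k n → ∃[ j ] + k * j ≡ 1ℤ mod n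
inverse-mod {k} {n} k⊥n with ℕCoprime.coprime-Bézout k⊥n
... | Bézout.+- x y 1+yn≡xk = + x , ≡-mod-trans (≡-mod-reflexive (begin
  + k * + x           ≡⟨ ℤ.pos-* k x ⟨
  + (k ℕ.* x)         ≡⟨ cong +_ (trans (ℕ.*-comm k x) (sym 1+yn≡xk)) ⟩
  + (1 ℕ.+ y ℕ.* n)   ≡⟨ ℤ.pos-+ 1 (y ℕ.* n) ⟩
  1ℤ + + (y ℕ.* n)    ≡⟨ cong (_+_ 1ℤ) (ℤ.pos-* y n) ⟩
  1ℤ + + y * + n      ∎)) (x+kn≡x-mod 1ℤ (+ y))
  where open ≡-Reasoning
... | Bézout.-+ x y 1+xk≡yn = - + x , ≡-mod-trans (≡-mod-reflexive (begin
  + k * - + x                ≡⟨ rearrange (+ k) (+ x) ⟩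
  1ℤ - (1ℤ + + x * + k)      ≡⟨ cong (λ t → 1ℤ - t) 1+xk≡yn′ ⟩
  1ℤ - + y * + n             ≡⟨ rearrange′ (+ y) (+ n) ⟩
  1ℤ + - + y * + n           ∎)) (x+kn≡x-mod 1ℤ (- + y))
  where
  open ≡-Reasoning
  rearrange : ∀ k x → k * - x ≡ 1ℤ - (1ℤ + x * k)
  rearrange = solve-∀
  rearrange′ : ∀ y n → 1ℤ - y * n ≡ 1ℤ + - y * n
  rearrange′ = solve-∀
  1+xk≡yn′ : 1ℤ + + x * + k ≡ + y * + n
  1+xk≡yn′ = begin
    1ℤ + + x * + k     ≡⟨ cong (_+_ 1ℤ) (ℤ.pos-* x k) ⟨
    1ℤ + + (x ℕ.* k)   ≡⟨ ℤ.pos-+ 1 (x ℕ.* k) ⟨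
    + (1 ℕ.+ x ℕ.* k)  ≡⟨ cong +_ 1+xk≡yn ⟩
    + (y ℕ.* n)        ≡⟨ ℤ.pos-* y n ⟩
    + y * + n          ∎

-- Small and large primes

prime<5⇒≡2⊎≡3 : ∀ {p} → Prime p → p ℕ.< 5 → p ≡ 2 ⊎ p ≡ 3
prime<5⇒≡2⊎≡3 {2} _ _ = inj₁ refl
prime<5⇒≡2⊎≡3 {3} _ _ = inj₂ refl
prime<5⇒≡2⊎≡3 {4} 4-prime _ = contradiction 4-prime (composite⇒¬prime composite[4])
prime<5⇒≡2⊎≡3 {suc (suc (suc (suc (suc _))))} _ (s≤s (s≤s (s≤s (s≤s (s≤s ())))))

prime∤⇒coprime : ∀ {p m} → Prime p → ¬ p ℕ.∣ m → Coprime p m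
prime∤⇒coprime p-prime p∤m (i∣p , i∣m) with prime⇒irreducible p-prime i∣p
... | inj₁ i≡1 = i≡1
... | inj₂ refl = contradiction i∣m p∤m

prime∣^⇒prime∣ : ∀ {p m} k → Prime p → p ℕ.∣ m ^ k → p ℕ.∣ m
prime∣^⇒prime∣ zero    p-prime p∣1 = contradiction (ℕ.∣1⇒≡1 p∣1) (λ { refl → ¬prime[1] p-prime })
prime∣^⇒prime∣ {m = m} (suc k) p-prime p∣m*m^k with euclidsLemma m (m ^ k) p-prime p∣m*m^k
... | inj₁ p∣m   = p∣m
... | inj₂ p∣m^k = prime∣^⇒prime∣ k p-prime p∣m^k

prime∣24^⇒<5 : ∀ {p} e → Prime p → p ℕ.∣ 24 ^ e → p ℕ.< 5
prime∣24^⇒<5 e p-prime p∣24^e with euclidsLemma (2 ^ 3) 3 p-prime (prime∣^⇒prime∣ e p-prime p∣24^e)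
... | inj₁ p∣2^3 = s≤s (ℕ.≤-trans (ℕ.∣⇒≤ (prime∣^⇒prime∣ 3 p-prime p∣2^3)) (ℕ.m≤m+n 2 2))
... | inj₂ p∣3   = s≤s (ℕ.≤-trans (ℕ.∣⇒≤ p∣3) (ℕ.m≤m+n 3 1))

separated-prime-factors⇒coprime : ∀ {m n} b .{{_ : NonZero n}} → (∀ p → Prime p → p ℕ.∣ m → p ℕ.< b) →
  (∀ p → Prime p → p ℕ.∣ n → b ℕ.≤ p) → Coprime m n
separated-prime-factors⇒coprime {n = n} b m-small n-large {zero} (_ , 0∣n) = contradiction (ℕ.0∣⇒≡0 0∣n) (ℕ.≢-nonZero⁻¹ n)
separated-prime-factors⇒coprime {n = n} b m-small n-large {i@(suc _)} (i∣m , i∣n) with factorise i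
... | record { factors = [] ; isFactorisation = i≡1 } = i≡1
... | record { factors = p ∷ ps ; isFactorisation = i≡p*∏ ; factorsPrime = p-prime ∷ _ } =
  contradiction (n-large p p-prime (ℕ.∣-trans p∣i i∣n)) (ℕ.<⇒≱ (m-small p p-prime (ℕ.∣-trans p∣i i∣m)))
  where
  p∣i : p ℕ.∣ i
  p∣i = subst (p ℕ.∣_) (sym i≡p*∏) (ℕ.m∣m*n (product ps))

-- Integer 2×2 matrices modulo n

record Matℤ : Set where
  constructor matℤ
  field a b c d : ℤ

matℤ-cong : ∀ {a b c d a′ b′ c′ d′} → a ≡ a′ → b ≡ b′ → c ≡ c′ → d ≡ d′ → matℤ a b c d ≡ matℤ a′ b′ c′ d′
matℤ-cong refl refl refl refl = refl

scalar : ℤ → Matℤ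
scalar s = matℤ s 0ℤ 0ℤ s

1ᴹ : Matℤ
1ᴹ = scalar 1ℤ

detᴹ : Matℤ → ℤ
detᴹ (matℤ a b c d) = a * d - b * c

adj : Matℤ → Matℤ
adj (matℤ a b c d) = matℤ d (- b) (- c) a

infix 4 _≋_mod_
record _≋_mod_ (A B : Matℤ) (n : ℕ) : Set where
  constructor entrywise
  open Matℤ
  field
    a-mod : a A ≡ a B mod n
    b-mod : b A ≡ b B mod n
    c-mod : c A ≡ c B mod n
    d-mod : d A ≡ d B mod n

private variable
  A B C A′ B′ : Matℤ

≋-mod-reflexive : A ≡ B → A ≋ B mod n
≋-mod-reflexive refl = entrywise ≡-mod-refl ≡-mod-refl ≡-mod-refl ≡-mod-refl

≋-mod-refl : A ≋ A mod n
≋-mod-refl = ≋-mod-reflexive refl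

≋-mod-sym : A ≋ B mod n → B ≋ A mod n
≋-mod-sym (entrywise p q r s) = entrywise (≡-mod-sym p) (≡-mod-sym q) (≡-mod-sym r) (≡-mod-sym s)

≋-mod-trans : A ≋ B mod n → B ≋ C mod n → A ≋ C mod n
≋-mod-trans (entrywise p q r s) (entrywise p′ q′ r′ s′) =
  entrywise (≡-mod-trans p p′) (≡-mod-trans q q′) (≡-mod-trans r r′) (≡-mod-trans s s′)

≋-mod-setoid : ℕ → Setoid _ _
≋-mod-setoid n = record
  { Carrier = Matℤ
  ; _≈_ = λ A B → A ≋ B mod n
  ; isEquivalence = record { refl = ≋-mod-refl ; sym = ≋-mod-sym ; trans = ≋-mod-trans }
  }

≋-mod-∣ : m ℕ.∣ n → A ≋ B mod n → A ≋ B mod m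
≋-mod-∣ m∣n (entrywise p q r s) = entrywise (≡-mod-∣ m∣n p) (≡-mod-∣ m∣n q) (≡-mod-∣ m∣n r) (≡-mod-∣ m∣n s)

≋-mod-coprime-* : Coprime m n → A ≋ B mod m → A ≋ B mod n → A ≋ B mod (m ℕ.* n)
≋-mod-coprime-* m⊥n (entrywise p q r s) (entrywise p′ q′ r′ s′) = entrywise
  (≡-mod-coprime-* m⊥n p p′) (≡-mod-coprime-* m⊥n q q′) (≡-mod-coprime-* m⊥n r r′) (≡-mod-coprime-* m⊥n s s′)

≋-mod-1 : A ≋ B mod 1
≋-mod-1 = entrywise ≡-mod-1 ≡-mod-1 ≡-mod-1 ≡-mod-1

scalar-cong-mod : x ≡ y mod n → scalar x ≋ scalar y mod n
scalar-cong-mod x≡y = entrywise x≡y ≡-mod-refl ≡-mod-refl x≡y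

detᴹ-cong-mod : A ≋ B mod n → detᴹ A ≡ detᴹ B mod n
detᴹ-cong-mod (entrywise p q r s) = +-cong-mod (*-cong-mod p s) (neg-cong-mod (*-cong-mod q r))

-- Opaque, so that unification treats matrix products as rigid.
opaque
  infixl 7 _*ᴹ_

  _*ᴹ_ : Matℤ → Matℤ → Matℤ
  matℤ a b c d *ᴹ matℤ a′ b′ c′ d′ =
    matℤ (a * a′ + b * c′) (a * b′ + b * d′) (c * a′ + d * c′) (c * b′ + d * d′)

  *ᴹ-assoc : ∀ A B C → A *ᴹ B *ᴹ C ≡ A *ᴹ (B *ᴹ C)
  *ᴹ-assoc (matℤ a b c d) (matℤ e f g h) (matℤ i j k l) =
    matℤ-cong (entry a b e f g h i k) (entry a b e f g h j l) (entry c d e f g h i k) (entry c d e f g h j l)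
    where
    entry : ∀ a b e f g h i k → (a * e + b * g) * i + (a * f + b * h) * k ≡ a * (e * i + f * k) + b * (g * i + h * k)
    entry = solve-∀

  *ᴹ-identityˡ : ∀ A → 1ᴹ *ᴹ A ≡ A
  *ᴹ-identityˡ (matℤ a b c d) = matℤ-cong (first a c) (first b d) (second a c) (second b d)
    where
    first : ∀ x y → 1ℤ * x + 0ℤ * y ≡ x
    first = solve-∀
    second : ∀ x y → 0ℤ * x + 1ℤ * y ≡ y
    second = solve-∀

  *ᴹ-identityʳ : ∀ A → A *ᴹ 1ᴹ ≡ A
  *ᴹ-identityʳ (matℤ a b c d) = matℤ-cong (first a b) (second a b) (first c d) (second c d)
    where
    first : ∀ x y → x * 1ℤ + y * 0ℤ ≡ x
    first = solve-∀
    second : ∀ x y → x * 0ℤ + y * 1ℤ ≡ y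
    second = solve-∀

  detᴹ-*ᴹ : ∀ A B → detᴹ (A *ᴹ B) ≡ detᴹ A * detᴹ B
  detᴹ-*ᴹ (matℤ a b c d) (matℤ e f g h) = cauchy-binet a b c d e f g h
    where
    cauchy-binet : ∀ a b c d e f g h →
      (a * e + b * g) * (c * f + d * h) - (a * f + b * h) * (c * e + d * g) ≡ (a * d - b * c) * (e * h - f * g)
    cauchy-binet = solve-∀

  adj-*ᴹ : ∀ A → adj A *ᴹ A ≡ scalar (detᴹ A)
  adj-*ᴹ (matℤ a b c d) = matℤ-cong (diagonal a b c d) (off-diagonal d b) (off-diagonal′ c a) (diagonal′ a b c d)
    where
    diagonal : ∀ a b c d → d * a + - b * c ≡ a * d - b * c
    diagonal = solve-∀
    diagonal′ : ∀ a b c d → - c * b + a * d ≡ a * d - b * c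
    diagonal′ = solve-∀
    off-diagonal : ∀ d b → d * b + - b * d ≡ 0ℤ
    off-diagonal = solve-∀
    off-diagonal′ : ∀ c a → - c * a + a * c ≡ 0ℤ
    off-diagonal′ = solve-∀

  scalar-*ᴹ : ∀ s t → scalar s *ᴹ scalar t ≡ scalar (s * t)
  scalar-*ᴹ s t = matℤ-cong (diagonal s t) (off-diagonal s t) (off-diagonal′ s t) (diagonal′ s t)
    where
    diagonal : ∀ s t → s * t + 0ℤ * 0ℤ ≡ s * t
    diagonal = solve-∀
    diagonal′ : ∀ s t → 0ℤ * 0ℤ + s * t ≡ s * t
    diagonal′ = solve-∀
    off-diagonal : ∀ s t → s * 0ℤ + 0ℤ * t ≡ 0ℤ
    off-diagonal = solve-∀
    off-diagonal′ : ∀ s t → 0ℤ * t + s * 0ℤ ≡ 0ℤ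
    off-diagonal′ = solve-∀

  *ᴹ-cong-mod : A ≋ A′ mod n → B ≋ B′ mod n → A *ᴹ B ≋ A′ *ᴹ B′ mod n
  *ᴹ-cong-mod (entrywise p q r s) (entrywise p′ q′ r′ s′) = entrywise
    (+-cong-mod (*-cong-mod p p′) (*-cong-mod q r′)) (+-cong-mod (*-cong-mod p q′) (*-cong-mod q s′))
    (+-cong-mod (*-cong-mod r p′) (*-cong-mod s r′)) (+-cong-mod (*-cong-mod r q′) (*-cong-mod s s′))

infixr 8 _^ᴹ_
_^ᴹ_ : Matℤ → ℕ → Matℤ
A ^ᴹ zero  = 1ᴹ
A ^ᴹ suc k = A *ᴹ A ^ᴹ k

^ᴹ-+ : ∀ A i j → A ^ᴹ (i ℕ.+ j) ≡ A ^ᴹ i *ᴹ A ^ᴹ j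
^ᴹ-+ A zero    j = sym (*ᴹ-identityˡ (A ^ᴹ j))
^ᴹ-+ A (suc i) j = trans (cong (A *ᴹ_) (^ᴹ-+ A i j)) (sym (*ᴹ-assoc A (A ^ᴹ i) (A ^ᴹ j)))

^ᴹ-* : ∀ A i j → A ^ᴹ (i ℕ.* j) ≡ (A ^ᴹ i) ^ᴹ j
^ᴹ-* A i zero    = cong (A ^ᴹ_) (ℕ.*-zeroʳ i)
^ᴹ-* A i (suc j) = begin
  A ^ᴹ (i ℕ.* suc j)            ≡⟨ cong (A ^ᴹ_) (ℕ.*-suc i j) ⟩
  A ^ᴹ (i ℕ.+ i ℕ.* j)          ≡⟨ ^ᴹ-+ A i (i ℕ.* j) ⟩
  A ^ᴹ i *ᴹ A ^ᴹ (i ℕ.* j)      ≡⟨ cong (A ^ᴹ i *ᴹ_) (^ᴹ-* A i j) ⟩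
  A ^ᴹ i *ᴹ (A ^ᴹ i) ^ᴹ j       ∎
  where open ≡-Reasoning

1ᴹ-^ᴹ : ∀ k → 1ᴹ ^ᴹ k ≡ 1ᴹ
1ᴹ-^ᴹ zero    = refl
1ᴹ-^ᴹ (suc k) = trans (cong (1ᴹ *ᴹ_) (1ᴹ-^ᴹ k)) (*ᴹ-identityˡ 1ᴹ)

^ᴹ-cong-mod : ∀ k → A ≋ B mod n → A ^ᴹ k ≋ B ^ᴹ k mod n
^ᴹ-cong-mod zero    A≋B = ≋-mod-refl
^ᴹ-cong-mod (suc k) A≋B = *ᴹ-cong-mod A≋B (^ᴹ-cong-mod k A≋B)

≋1ᴹ⇒^ᴹ≋1ᴹ : ∀ k → A ≋ 1ᴹ mod n → A ^ᴹ k ≋ 1ᴹ mod n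
≋1ᴹ⇒^ᴹ≋1ᴹ k A≋1 = ≋-mod-trans (^ᴹ-cong-mod k A≋1) (≋-mod-reflexive (1ᴹ-^ᴹ k))

detᴹ-inverse-mod : A *ᴹ B ≋ 1ᴹ mod n → detᴹ A * detᴹ B ≡ 1ℤ mod n
detᴹ-inverse-mod {A} {B} AB≋1 = ≡-mod-trans (≡-mod-reflexive (sym (detᴹ-*ᴹ A B))) (detᴹ-cong-mod AB≋1)

-- The adjugate gives det A · B ≡ adj A, so B·A ≡ det B · adj A · A ≡ det B · det A ≡ 1.
inverseʳ⇒inverseˡ-mod : A *ᴹ B ≋ 1ᴹ mod n → B *ᴹ A ≋ 1ᴹ mod n
inverseʳ⇒inverseˡ-mod {A} {B} {n} AB≋1 = begin
  B *ᴹ A                                     ≡⟨ *ᴹ-identityˡ (B *ᴹ A) ⟨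
  1ᴹ *ᴹ (B *ᴹ A)                             ≈⟨ *ᴹ-cong-mod βδ≋1 ≋-mod-refl ⟨
  scalar (β * δ) *ᴹ (B *ᴹ A)                 ≡⟨ cong (_*ᴹ (B *ᴹ A)) (sym (scalar-*ᴹ β δ)) ⟩
  scalar β *ᴹ scalar δ *ᴹ (B *ᴹ A)           ≡⟨ *ᴹ-assoc (scalar β) (scalar δ) (B *ᴹ A) ⟩
  scalar β *ᴹ (scalar δ *ᴹ (B *ᴹ A))         ≡⟨ cong (scalar β *ᴹ_) (*ᴹ-assoc (scalar δ) B A) ⟨
  scalar β *ᴹ ((scalar δ *ᴹ B) *ᴹ A)         ≡⟨ cong (λ X → scalar β *ᴹ (X *ᴹ B *ᴹ A)) (sym (adj-*ᴹ A)) ⟩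
  scalar β *ᴹ (adj A *ᴹ A *ᴹ B *ᴹ A)         ≡⟨ cong (λ X → scalar β *ᴹ (X *ᴹ A)) (*ᴹ-assoc (adj A) A B) ⟩
  scalar β *ᴹ (adj A *ᴹ (A *ᴹ B) *ᴹ A)       ≈⟨ *ᴹ-cong-mod ≋-mod-refl (*ᴹ-cong-mod (*ᴹ-cong-mod ≋-mod-refl AB≋1) ≋-mod-refl) ⟩
  scalar β *ᴹ (adj A *ᴹ 1ᴹ *ᴹ A)             ≡⟨ cong (λ X → scalar β *ᴹ (X *ᴹ A)) (*ᴹ-identityʳ (adj A)) ⟩
  scalar β *ᴹ (adj A *ᴹ A)                   ≡⟨ cong (scalar β *ᴹ_) (adj-*ᴹ A) ⟩
  scalar β *ᴹ scalar δ                       ≡⟨ scalar-*ᴹ β δ ⟩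
  scalar (β * δ)                             ≈⟨ βδ≋1 ⟩
  1ᴹ                                         ∎
  where
  open SetoidReasoning (≋-mod-setoid n)
  δ β : ℤ
  δ = detᴹ A
  β = detᴹ B
  βδ≋1 : scalar (β * δ) ≋ 1ᴹ mod n
  βδ≋1 = scalar-cong-mod (≡-mod-trans (≡-mod-reflexive (ℤ.*-comm β δ)) (detᴹ-inverse-mod AB≋1))

infix 4 _≋?_mod_
_≋?_mod_ : ∀ A B n → Dec (A ≋ B mod n)
A ≋? B mod n = map′ (λ (p , q , r , s) → entrywise p q r s) (λ (entrywise p q r s) → p , q , r , s)
  ((a A ≡? a B mod n) ×-dec (b A ≡? b B mod n) ×-dec (c A ≡? c B mod n) ×-dec (d A ≡? d B mod n))
  where open Matℤ

inverse-unique-mod : A ≋ B mod n → A *ᴹ A′ ≋ 1ᴹ mod n → B *ᴹ B′ ≋ 1ᴹ mod n → A′ ≋ B′ mod n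
inverse-unique-mod {A} {B} {n} {A′} {B′} A≋B AA′≋1 BB′≋1 = begin
  A′                  ≡⟨ *ᴹ-identityʳ A′ ⟨
  A′ *ᴹ 1ᴹ            ≈⟨ *ᴹ-cong-mod ≋-mod-refl BB′≋1 ⟨
  A′ *ᴹ (B *ᴹ B′)     ≡⟨ *ᴹ-assoc A′ B B′ ⟨
  A′ *ᴹ B *ᴹ B′       ≈⟨ *ᴹ-cong-mod (*ᴹ-cong-mod ≋-mod-refl A≋B) ≋-mod-refl ⟨
  A′ *ᴹ A *ᴹ B′       ≈⟨ *ᴹ-cong-mod (inverseʳ⇒inverseˡ-mod AA′≋1) ≋-mod-refl ⟩
  1ᴹ *ᴹ B′            ≡⟨ *ᴹ-identityˡ B′ ⟩
  B′                  ∎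
  where open SetoidReasoning (≋-mod-setoid n)

detᴹ-commutator : A *ᴹ A′ ≋ 1ᴹ mod n → B *ᴹ B′ ≋ 1ᴹ mod n → detᴹ (A *ᴹ B *ᴹ A′ *ᴹ B′) ≡ 1ℤ mod n
detᴹ-commutator {A} {A′} {n} {B} {B′} AA′≋1 BB′≋1 = begin
  detᴹ (A *ᴹ B *ᴹ A′ *ᴹ B′)                       ≡⟨ detᴹ-*ᴹ (A *ᴹ B *ᴹ A′) B′ ⟩
  detᴹ (A *ᴹ B *ᴹ A′) * detᴹ B′                   ≡⟨ cong (_* detᴹ B′) (detᴹ-*ᴹ (A *ᴹ B) A′) ⟩
  detᴹ (A *ᴹ B) * detᴹ A′ * detᴹ B′               ≡⟨ cong (λ x → x * detᴹ A′ * detᴹ B′) (detᴹ-*ᴹ A B) ⟩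
  detᴹ A * detᴹ B * detᴹ A′ * detᴹ B′             ≡⟨ regroup (detᴹ A) (detᴹ B) (detᴹ A′) (detᴹ B′) ⟩
  (detᴹ A * detᴹ A′) * (detᴹ B * detᴹ B′)         ≈⟨ *-cong-mod (detᴹ-inverse-mod AA′≋1) (detᴹ-inverse-mod BB′≋1) ⟩
  1ℤ * 1ℤ                                         ≡⟨⟩
  1ℤ                                              ∎
  where
  open SetoidReasoning (≡-mod-setoid n)
  regroup : ∀ a b a′ b′ → a * b * a′ * b′ ≡ (a * a′) * (b * b′)
  regroup = solve-∀

-- The exponent of GL₂(ℤ/n) when n has no prime factor ≥ 5

module _ (n : ℕ) .{{_ : NonZero n}} (P : Matℤ → Set) where

  ForResidues : Set
  ForResidues = ∀ {a} → a ℕ.< n → ∀ {b} → b ℕ.< n → ∀ {c} → c ℕ.< n → ∀ {d} → d ℕ.< n →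
    P (matℤ (+ a) (+ b) (+ c) (+ d))

  forResidues? : (∀ A → Dec (P A)) → Dec ForResidues
  forResidues? P? = allUpTo? (λ a → allUpTo? (λ b → allUpTo? (λ c → allUpTo? (λ d →
    P? (matℤ (+ a) (+ b) (+ c) (+ d))) n) n) n) n

  forResidues⇒∀ : (∀ {A B} → A ≋ B mod n → P A → P B) → ForResidues → ∀ A → P A
  forResidues⇒∀ P-resp ∀P (matℤ a b c d) = P-resp (entrywise (%ℕ-≡-mod a) (%ℕ-≡-mod b) (%ℕ-≡-mod c) (%ℕ-≡-mod d))
    (∀P (n%ℕd<d a n) (n%ℕd<d b n) (n%ℕd<d c n) (n%ℕd<d d n))

SingularOr^24≋1 : ℕ → Matℤ → Set
SingularOr^24≋1 p A = detᴹ A ≡ 0ℤ mod p ⊎ A ^ᴹ 24 ≋ 1ᴹ mod p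

singularOr^24≋1-resp : A ≋ B mod n → SingularOr^24≋1 n A → SingularOr^24≋1 n B
singularOr^24≋1-resp A≋B (inj₁ detA≡0) = inj₁ (≡-mod-trans (≡-mod-sym (detᴹ-cong-mod A≋B)) detA≡0)
singularOr^24≋1-resp A≋B (inj₂ A²⁴≋1) = inj₂ (≋-mod-trans (≋-mod-sym (^ᴹ-cong-mod 24 A≋B)) A²⁴≋1)

singularOr^24≋1? : ∀ p A → Dec (SingularOr^24≋1 p A)
singularOr^24≋1? p A = (detᴹ A ≡? 0ℤ mod p) ⊎-dec (A ^ᴹ 24 ≋? 1ᴹ mod p)

-- The groups GL₂(𝔽₂) and GL₂(𝔽₃) have exponent dividing 24: checked by evaluation.
opaque
  unfolding _*ᴹ_
  singularOr^24≋1-2-3 : ∀ {p} → p ≡ 2 ⊎ p ≡ 3 → ∀ A → SingularOr^24≋1 p A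
  singularOr^24≋1-2-3 (inj₁ refl) = forResidues⇒∀ 2 (SingularOr^24≋1 2) singularOr^24≋1-resp
    (toWitness {a? = forResidues? 2 (SingularOr^24≋1 2) (singularOr^24≋1? 2)} _)
  singularOr^24≋1-2-3 (inj₂ refl) = forResidues⇒∀ 3 (SingularOr^24≋1 3) singularOr^24≋1-resp
    (toWitness {a? = forResidues? 3 (SingularOr^24≋1 3) (singularOr^24≋1? 3)} _)

^ᴹ24≋1ᴹ-mod-2-3 : ∀ {p u} → p ≡ 2 ⊎ p ≡ 3 → detᴹ A * u ≡ 1ℤ mod p → A ^ᴹ 24 ≋ 1ᴹ mod p
^ᴹ24≋1ᴹ-mod-2-3 {A} {p} {u} p≡2⊎3 detA*u≡1 with singularOr^24≋1-2-3 p≡2⊎3 A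
... | inj₂ A²⁴≋1 = A²⁴≋1
... | inj₁ detA≡0 = contradiction (1≡0-mod⇒≡1 1≡0) (p≢1 p≡2⊎3)
  where
  1≡0 : 1ℤ ≡ 0ℤ mod p
  1≡0 = ≡-mod-trans (≡-mod-sym detA*u≡1)
    (≡-mod-trans (*-congʳ-mod u detA≡0) (≡-mod-reflexive (ℤ.*-zeroˡ u)))
  p≢1 : p ≡ 2 ⊎ p ≡ 3 → p ≢ 1
  p≢1 (inj₁ refl) ()
  p≢1 (inj₂ refl) ()

opaque
  unfolding _*ᴹ_

  infix 9 1ᴹ+_·_
  1ᴹ+_·_ : ℤ → Matℤ → Matℤ
  1ᴹ+ x · matℤ a b c d = matℤ (1ℤ + x * a) (x * b) (x * c) (1ℤ + x * d)

  1ᴹ+0· : ∀ Y → 1ᴹ+ 0ℤ · Y ≡ 1ᴹ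
  1ᴹ+0· (matℤ a b c d) = matℤ-cong (ℤ.+-identityʳ 1ℤ) refl refl (ℤ.+-identityʳ 1ℤ)

  1ᴹ+-cong-mod : ∀ Y → x ≡ y mod n → 1ᴹ+ x · Y ≋ 1ᴹ+ y · Y mod n
  1ᴹ+-cong-mod (matℤ a b c d) x≡y = entrywise
    (+-congˡ-mod 1ℤ (*-congʳ-mod a x≡y)) (*-congʳ-mod b x≡y) (*-congʳ-mod c x≡y) (+-congˡ-mod 1ℤ (*-congʳ-mod d x≡y))

  -- (1 + xY)(1 + yY) = 1 + (x + y)Y + xy·Y²
  1ᴹ+-*ᴹ : ∀ Y → x * y ≡ 0ℤ mod n → 1ᴹ+ x · Y *ᴹ 1ᴹ+ y · Y ≋ 1ᴹ+ (x + y) · Y mod n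
  1ᴹ+-*ᴹ {x = x} {y = y} {n = n} (matℤ a b c d) xy≡0 = entrywise
    (negligible (diagonal x y a b c)) (negligible (off-diagonal x y b a d))
    (negligible (off-diagonal′ x y c a d)) (negligible (diagonal′ x y d c b))
    where
    negligible : ∀ {u v w} → u ≡ v + x * y * w → u ≡ v mod n
    negligible {v = v} {w} eq = ≡-mod-trans (≡-mod-reflexive eq) (≡0⇒+*≡-mod xy≡0 v w)
    diagonal : ∀ x y a b c → (1ℤ + x * a) * (1ℤ + y * a) + x * b * (y * c) ≡ 1ℤ + (x + y) * a + x * y * (a * a + b * c)
    diagonal = solve-∀
    off-diagonal : ∀ x y b a d → (1ℤ + x * a) * (y * b) + x * b * (1ℤ + y * d) ≡ (x + y) * b + x * y * (a * b + b * d)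
    off-diagonal = solve-∀
    off-diagonal′ : ∀ x y c a d → x * c * (1ℤ + y * a) + (1ℤ + x * d) * (y * c) ≡ (x + y) * c + x * y * (c * a + d * c)
    off-diagonal′ = solve-∀
    diagonal′ : ∀ x y d c b → x * c * (y * b) + (1ℤ + x * d) * (1ℤ + y * d) ≡ 1ℤ + (x + y) * d + x * y * (c * b + d * d)
    diagonal′ = solve-∀

  ≋1ᴹ⇒≡1ᴹ+ : A ≋ 1ᴹ mod n → ∃[ Y ] A ≡ 1ᴹ+ + n · Y
  ≋1ᴹ⇒≡1ᴹ+ {n = n} (entrywise (from-∣ (divides p a≡)) (from-∣ (divides q b≡)) (from-∣ (divides r c≡)) (from-∣ (divides s d≡))) =
    matℤ p q r s , matℤ-cong (diagonal a≡) (off-diagonal b≡) (off-diagonal c≡) (diagonal d≡)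
    where
    diagonal : ∀ {x q} → x - 1ℤ ≡ q * + n → x ≡ 1ℤ + + n * q
    diagonal {x} {q} eq = trans (sym (x-1+1 x)) (trans (cong (_+ 1ℤ) eq) (swap q (+ n)))
      where
      x-1+1 : ∀ x → x - 1ℤ + 1ℤ ≡ x
      x-1+1 = solve-∀
      swap : ∀ q n → q * n + 1ℤ ≡ 1ℤ + n * q
      swap = solve-∀
    off-diagonal : ∀ {x q} → x - 0ℤ ≡ q * + n → x ≡ + n * q
    off-diagonal {x} {q} eq = trans (sym (ℤ.+-identityʳ x)) (trans eq (ℤ.*-comm q (+ n)))

1ᴹ+-^ᴹ : ∀ Y k → x * x ≡ 0ℤ mod n → (1ᴹ+ x · Y) ^ᴹ k ≋ 1ᴹ+ (x * + k) · Y mod n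
1ᴹ+-^ᴹ {x} Y zero    x²≡0 = ≋-mod-reflexive (sym (trans (cong (1ᴹ+_· Y) (ℤ.*-zeroʳ x)) (1ᴹ+0· Y)))
1ᴹ+-^ᴹ {x} {n} Y (suc k) x²≡0 = begin
  1ᴹ+ x · Y *ᴹ (1ᴹ+ x · Y) ^ᴹ k       ≈⟨ *ᴹ-cong-mod ≋-mod-refl (1ᴹ+-^ᴹ Y k x²≡0) ⟩
  1ᴹ+ x · Y *ᴹ 1ᴹ+ (x * + k) · Y      ≈⟨ 1ᴹ+-*ᴹ Y x²k≡0 ⟩
  1ᴹ+ (x + x * + k) · Y               ≡⟨ cong (1ᴹ+_· Y) (x+xk≡x[1+k] x (+ k)) ⟩
  1ᴹ+ (x * (1ℤ + + k)) · Y            ≡⟨ cong (λ t → 1ᴹ+ (x * t) · Y) (ℤ.pos-+ 1 k) ⟨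
  1ᴹ+ (x * + suc k) · Y               ∎
  where
  open SetoidReasoning (≋-mod-setoid n)
  x+xk≡x[1+k] : ∀ x k → x + x * k ≡ x * (1ℤ + k)
  x+xk≡x[1+k] = solve-∀
  x²k≡0 : x * (x * + k) ≡ 0ℤ mod n
  x²k≡0 = ≡-mod-trans (≡-mod-reflexive (sym (ℤ.*-assoc x x (+ k)))) (≡-mod-trans (*-congʳ-mod (+ k) x²≡0) (≡-mod-reflexive (ℤ.*-zeroˡ (+ k))))

-- (1 + mY)ᵏ ≡ 1 + kmY modulo m², and both km and m² vanish modulo pm.
≋1ᴹ⇒^ᴹ≋1ᴹ-lift : ∀ {p m} k → p ℕ.∣ m → p ℕ.∣ k → A ≋ 1ᴹ mod m → A ^ᴹ k ≋ 1ᴹ mod (p ℕ.* m)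
≋1ᴹ⇒^ᴹ≋1ᴹ-lift {A} {p} {m} k p∣m p∣k A≋1 with ≋1ᴹ⇒≡1ᴹ+ A≋1
... | Y , refl = begin
  (1ᴹ+ + m · Y) ^ᴹ k         ≈⟨ 1ᴹ+-^ᴹ Y k m²≡0 ⟩
  1ᴹ+ (+ m * + k) · Y        ≈⟨ 1ᴹ+-cong-mod Y mk≡0 ⟩
  1ᴹ+ 0ℤ · Y                 ≡⟨ 1ᴹ+0· Y ⟩
  1ᴹ                         ∎
  where
  open SetoidReasoning (≋-mod-setoid (p ℕ.* m))
  m²≡0 : + m * + m ≡ 0ℤ mod (p ℕ.* m)
  m²≡0 = ≡-mod-trans (≡-mod-reflexive (sym (ℤ.pos-* m m))) (∣⇒≡0-mod (ℕ.*-monoˡ-∣ m p∣m))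
  mk≡0 : + m * + k ≡ 0ℤ mod (p ℕ.* m)
  mk≡0 = ≡-mod-trans (≡-mod-reflexive (sym (ℤ.pos-* m k)))
    (∣⇒≡0-mod (subst (ℕ._∣ m ℕ.* k) (ℕ.*-comm m p) (ℕ.*-monoʳ-∣ m p∣k)))

SmallPrime : ℕ → Set
SmallPrime p = Prime p × p ℕ.< 5

exponent-24-product : ∀ ps → All SmallPrime ps → ∀ {A u} → detᴹ A * u ≡ 1ℤ mod product ps →
  ∃[ e ] A ^ᴹ (24 ^ e) ≋ 1ᴹ mod product ps
exponent-24-product []       []                             _         = 0 , ≋-mod-1
exponent-24-product (p ∷ ps) ((p-prime , p<5) ∷ ps-small) {A} detA*u≡1
  with exponent-24-product ps ps-small (≡-mod-∣ (ℕ.n∣m*n p) detA*u≡1)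
... | e , A^24^e≋1 = suc e , mod-p*m (p ℕ.∣? product ps)
  where
  p≡2⊎3 : p ≡ 2 ⊎ p ≡ 3
  p≡2⊎3 = prime<5⇒≡2⊎≡3 p-prime p<5
  A^24^[1+e]≡[A^24^e]^24 : A ^ᴹ (24 ^ suc e) ≡ (A ^ᴹ (24 ^ e)) ^ᴹ 24
  A^24^[1+e]≡[A^24^e]^24 = trans (cong (A ^ᴹ_) (ℕ.*-comm 24 (24 ^ e))) (^ᴹ-* A (24 ^ e) 24)
  p∣24 : p ℕ.∣ 24
  p∣24 with p≡2⊎3
  ... | inj₁ refl = ℕ.divides 12 refl
  ... | inj₂ refl = ℕ.divides 8 refl
  mod-p*m : Dec (p ℕ.∣ product ps) → A ^ᴹ (24 ^ suc e) ≋ 1ᴹ mod (p ℕ.* product ps)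
  mod-p*m (yes p∣m) = subst (λ X → X ≋ 1ᴹ mod _) (sym A^24^[1+e]≡[A^24^e]^24) (≋1ᴹ⇒^ᴹ≋1ᴹ-lift 24 p∣m p∣24 A^24^e≋1)
  mod-p*m (no p∤m)  = ≋-mod-coprime-* (prime∤⇒coprime p-prime p∤m) mod-p mod-m
    where
    mod-p : A ^ᴹ (24 ^ suc e) ≋ 1ᴹ mod p
    mod-p = subst (λ X → X ≋ 1ᴹ mod p) (sym (^ᴹ-* A 24 (24 ^ e)))
      (≋1ᴹ⇒^ᴹ≋1ᴹ (24 ^ e) (^ᴹ24≋1ᴹ-mod-2-3 p≡2⊎3 (≡-mod-∣ (ℕ.m∣m*n (product ps)) detA*u≡1)))
    mod-m : A ^ᴹ (24 ^ suc e) ≋ 1ᴹ mod product ps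
    mod-m = subst (λ X → X ≋ 1ᴹ mod product ps) (sym A^24^[1+e]≡[A^24^e]^24) (≋1ᴹ⇒^ᴹ≋1ᴹ 24 A^24^e≋1)

exponent-24 : .{{_ : NonZero n}} → (∀ p → Prime p → p ℕ.∣ n → p ℕ.< 5) →
  ∀ {A u} → detᴹ A * u ≡ 1ℤ mod n → ∃[ e ] A ^ᴹ (24 ^ e) ≋ 1ᴹ mod n
exponent-24 {n = n} small-factors {A} {u} detA*u≡1 =
  subst (λ k → ∃[ e ] A ^ᴹ (24 ^ e) ≋ 1ᴹ mod k) (sym n≡∏)
    (exponent-24-product factors (all-small factors factorsPrime small-factors′)
      (subst (λ k → detᴹ A * u ≡ 1ℤ mod k) n≡∏ detA*u≡1))
  where
  open PrimeFactorisation (factorise n) renaming (isFactorisation to n≡∏)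
  small-factors′ : ∀ p → Prime p → p ℕ.∣ product factors → p ℕ.< 5
  small-factors′ p p-prime p∣∏ = small-factors p p-prime (subst (p ℕ.∣_) (sym n≡∏) p∣∏)
  all-small : ∀ ps → All Prime ps → (∀ p → Prime p → p ℕ.∣ product ps → p ℕ.< 5) → All SmallPrime ps
  all-small []       []                  _     = []
  all-small (p ∷ ps) (p-prime ∷ ps-prime) small =
    (p-prime , small p p-prime (ℕ.m∣m*n (product ps))) ∷ all-small ps ps-prime (λ q q-prime q∣ → small q q-prime (ℕ.∣n⇒∣m*n p q∣))

-- Generation of SL₂(ℤ/n) by elementary matrices

E₁₂ E₂₁ : ℤ → Matℤ
E₁₂ t = matℤ 1ℤ t 0ℤ 1ℤ
E₂₁ t = matℤ 1ℤ 0ℤ t 1ℤ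

opaque
  unfolding _*ᴹ_

  E₁₂-*ᴹ : ∀ t a b c d → E₁₂ t *ᴹ matℤ a b c d ≡ matℤ (a + t * c) (b + t * d) c d
  E₁₂-*ᴹ t a b c d = matℤ-cong (row₁ a c t) (row₁ b d t) (row₂ a c) (row₂ b d)
    where
    row₁ : ∀ a c t → 1ℤ * a + t * c ≡ a + t * c
    row₁ = solve-∀
    row₂ : ∀ a c → 0ℤ * a + 1ℤ * c ≡ c
    row₂ = solve-∀

  E₂₁-*ᴹ : ∀ t a b c d → E₂₁ t *ᴹ matℤ a b c d ≡ matℤ a b (c + t * a) (d + t * b)
  E₂₁-*ᴹ t a b c d = matℤ-cong (row₁ a c) (row₁ b d) (row₂ a c t) (row₂ b d t)
    where
    row₁ : ∀ a c → 1ℤ * a + 0ℤ * c ≡ a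
    row₁ = solve-∀
    row₂ : ∀ a c t → t * a + 1ℤ * c ≡ c + t * a
    row₂ = solve-∀

E₁₂-^ᴹ : ∀ k → E₁₂ 1ℤ ^ᴹ k ≡ E₁₂ (+ k)
E₁₂-^ᴹ zero    = refl
E₁₂-^ᴹ (suc k) = begin
  E₁₂ 1ℤ *ᴹ E₁₂ 1ℤ ^ᴹ k                         ≡⟨ cong (E₁₂ 1ℤ *ᴹ_) (E₁₂-^ᴹ k) ⟩
  E₁₂ 1ℤ *ᴹ E₁₂ (+ k)                           ≡⟨ E₁₂-*ᴹ 1ℤ 1ℤ (+ k) 0ℤ 1ℤ ⟩
  matℤ (1ℤ + 1ℤ * 0ℤ) (+ k + 1ℤ * 1ℤ) 0ℤ 1ℤ     ≡⟨ matℤ-cong refl (trans (ℤ.+-comm (+ k) 1ℤ) (sym (ℤ.pos-+ 1 k))) refl refl ⟩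
  E₁₂ (+ suc k)                                 ∎
  where open ≡-Reasoning

E₂₁-^ᴹ : ∀ k → E₂₁ 1ℤ ^ᴹ k ≡ E₂₁ (+ k)
E₂₁-^ᴹ zero    = refl
E₂₁-^ᴹ (suc k) = begin
  E₂₁ 1ℤ *ᴹ E₂₁ 1ℤ ^ᴹ k                         ≡⟨ cong (E₂₁ 1ℤ *ᴹ_) (E₂₁-^ᴹ k) ⟩
  E₂₁ 1ℤ *ᴹ E₂₁ (+ k)                           ≡⟨ E₂₁-*ᴹ 1ℤ 1ℤ 0ℤ (+ k) 1ℤ ⟩
  matℤ 1ℤ 0ℤ (+ k + 1ℤ * 1ℤ) (1ℤ + 1ℤ * 0ℤ)     ≡⟨ matℤ-cong refl refl (trans (ℤ.+-comm (+ k) 1ℤ) (sym (ℤ.pos-+ 1 k))) refl ⟩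
  E₂₁ (+ suc k)                                 ∎
  where open ≡-Reasoning

-- Closure under left multiplication by E₁₂(1) and E₂₁(1) suffices: modulo n, every
-- E₁₂(t) and E₂₁(t) is a power of these.
module SL₂-generation (n : ℕ) .{{_ : NonZero n}} (Q : Matℤ → Set)
  (Q-resp : ∀ {A B} → A ≋ B mod n → Q A → Q B) (Q-1ᴹ : Q 1ᴹ)
  (Q-E₁₂ : ∀ {A} → Q A → Q (E₁₂ 1ℤ *ᴹ A)) (Q-E₂₁ : ∀ {A} → Q A → Q (E₂₁ 1ℤ *ᴹ A)) where

  private
    Q-^ᴹ : ∀ {E} → (∀ {A} → Q A → Q (E *ᴹ A)) → ∀ k {A} → Q A → Q (E ^ᴹ k *ᴹ A)
    Q-^ᴹ {E} Q-E zero    {A} QA = subst Q (sym (*ᴹ-identityˡ A)) QA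
    Q-^ᴹ {E} Q-E (suc k) {A} QA = subst Q (sym (*ᴹ-assoc E (E ^ᴹ k) A)) (Q-E (Q-^ᴹ Q-E k QA))

    E₁₂≋E₁₂[%] : ∀ t → E₁₂ (+ (t %ℕ n)) ≋ E₁₂ t mod n
    E₁₂≋E₁₂[%] t = entrywise ≡-mod-refl (%ℕ-≡-mod t) ≡-mod-refl ≡-mod-refl

    E₂₁≋E₂₁[%] : ∀ t → E₂₁ (+ (t %ℕ n)) ≋ E₂₁ t mod n
    E₂₁≋E₂₁[%] t = entrywise ≡-mod-refl ≡-mod-refl (%ℕ-≡-mod t) ≡-mod-refl

  Q-addRow₁ : ∀ t a′ b′ {a b c d} → a′ + t * c ≡ a → b′ + t * d ≡ b → Q (matℤ a′ b′ c d) → Q (matℤ a b c d)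
  Q-addRow₁ t a′ b′ {a} {b} {c} {d} a≡ b≡ Q[A′] = Q-resp E₁₂A′≋A (Q-^ᴹ Q-E₁₂ (t %ℕ n) Q[A′])
    where
    E₁₂A′≋A : E₁₂ 1ℤ ^ᴹ (t %ℕ n) *ᴹ matℤ a′ b′ c d ≋ matℤ a b c d mod n
    E₁₂A′≋A = ≋-mod-trans (*ᴹ-cong-mod (≋-mod-trans (≋-mod-reflexive (E₁₂-^ᴹ (t %ℕ n))) (E₁₂≋E₁₂[%] t)) ≋-mod-refl)
      (≋-mod-reflexive (trans (E₁₂-*ᴹ t a′ b′ c d) (matℤ-cong a≡ b≡ refl refl)))

  Q-addRow₂ : ∀ t c′ d′ {a b c d} → c′ + t * a ≡ c → d′ + t * b ≡ d → Q (matℤ a b c′ d′) → Q (matℤ a b c d)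
  Q-addRow₂ t c′ d′ {a} {b} {c} {d} c≡ d≡ Q[A′] = Q-resp E₂₁A′≋A (Q-^ᴹ Q-E₂₁ (t %ℕ n) Q[A′])
    where
    E₂₁A′≋A : E₂₁ 1ℤ ^ᴹ (t %ℕ n) *ᴹ matℤ a b c′ d′ ≋ matℤ a b c d mod n
    E₂₁A′≋A = ≋-mod-trans (*ᴹ-cong-mod (≋-mod-trans (≋-mod-reflexive (E₂₁-^ᴹ (t %ℕ n))) (E₂₁≋E₂₁[%] t)) ≋-mod-refl)
      (≋-mod-reflexive (trans (E₂₁-*ᴹ t a b c′ d′) (matℤ-cong refl refl c≡ d≡)))

  private
    SL : Matℤ → Set
    SL A = detᴹ A ≡ 1ℤ mod n

    by-det : ∀ {x y} → x ≡ y → y ≡ 1ℤ mod n → x ≡ 1ℤ mod n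
    by-det eq = ≡-mod-trans (≡-mod-reflexive eq)

    x-y+y : ∀ x y → x - y + y ≡ x
    x-y+y = solve-∀

    Q-a≡1 : ∀ {b c d} → SL (matℤ 1ℤ b c d) → Q (matℤ 1ℤ b c d)
    Q-a≡1 {b} {c} {d} det≡1 =
      Q-addRow₂ c 0ℤ e (0+c*1 c) (x-y+y d (c * b)) $
      Q-addRow₁ b 1ℤ (b - b * e) (1+b*0 b) (x-y+y b (b * e)) $
      Q-resp (entrywise ≡-mod-refl b-be≡0 ≡-mod-refl (≡-mod-sym e≡1)) Q-1ᴹ
      where
      0+c*1 : ∀ c → 0ℤ + c * 1ℤ ≡ c
      0+c*1 = solve-∀
      1+b*0 : ∀ b → 1ℤ + b * 0ℤ ≡ 1ℤ
      1+b*0 = solve-∀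
      det[1bcd] : ∀ d b c → d - c * b ≡ 1ℤ * d - b * c
      det[1bcd] = solve-∀
      x-x*1 : ∀ x → x - x * 1ℤ ≡ 0ℤ
      x-x*1 = solve-∀
      e : ℤ
      e = d - c * b
      e≡1 : e ≡ 1ℤ mod n
      e≡1 = ≡-mod-trans (≡-mod-reflexive (det[1bcd] d b c)) det≡1
      b-be≡0 : 0ℤ ≡ b - b * e mod n
      b-be≡0 = ≡-mod-trans (≡-mod-reflexive (sym (x-x*1 b))) (+-congˡ-mod b (neg-cong-mod (*-congˡ-mod b (≡-mod-sym e≡1))))

    Q-c≡1 : ∀ {a b d} → SL (matℤ a b 1ℤ d) → Q (matℤ a b 1ℤ d)
    Q-c≡1 {a} {b} {d} det≡1 =
      Q-addRow₁ (a - 1ℤ) 1ℤ (b - (a - 1ℤ) * d) (1+[a-1]*1 a) (x-y+y b ((a - 1ℤ) * d)) $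
      Q-a≡1 (by-det (same-det a b d) det≡1)
      where
      1+[a-1]*1 : ∀ a → 1ℤ + (a - 1ℤ) * 1ℤ ≡ a
      1+[a-1]*1 = solve-∀
      same-det : ∀ a b d → 1ℤ * d - (b - (a - 1ℤ) * d) * 1ℤ ≡ a * d - b * 1ℤ
      same-det = solve-∀

    Q-c≡0 : ∀ {a b d} → SL (matℤ a b 0ℤ d) → Q (matℤ a b 0ℤ d)
    Q-c≡0 {a} {b} {d} det≡1 =
      Q-addRow₂ (- d) (d * a) (d + d * b) (da-da d a) (x+xy-xy d b) $
      Q-resp (entrywise ≡-mod-refl ≡-mod-refl (≡-mod-sym da≡1) ≡-mod-refl) $
      Q-c≡1 (by-det (det-identity a b d) (≡-mod-trans (≡0⇒+*≡-mod ad-1≡0 (a * d) b) ad≡1))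
      where
      da-da : ∀ d a → d * a + - d * a ≡ 0ℤ
      da-da = solve-∀
      x+xy-xy : ∀ x y → x + x * y + - x * y ≡ x
      x+xy-xy = solve-∀
      ad-b0≡ad : ∀ a b d → a * d - b * 0ℤ ≡ a * d
      ad-b0≡ad = solve-∀
      det-identity : ∀ a b d → a * (d + d * b) - b * 1ℤ ≡ a * d + (a * d - 1ℤ) * b
      det-identity = solve-∀
      ad≡1 : a * d ≡ 1ℤ mod n
      ad≡1 = by-det (sym (ad-b0≡ad a b d)) det≡1
      da≡1 : d * a ≡ 1ℤ mod n
      da≡1 = by-det (ℤ.*-comm d a) ad≡1
      ad-1≡0 : a * d - 1ℤ ≡ 0ℤ mod n
      ad-1≡0 = ≡-mod-trans (+-congʳ-mod (- 1ℤ) ad≡1) (≡-mod-reflexive (ℤ.+-inverseʳ 1ℤ))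

    Q-a≡0 : ∀ {b c d} → SL (matℤ 0ℤ b c d) → Q (matℤ 0ℤ b c d)
    Q-a≡0 {b} {c} {d} det≡1 =
      Q-addRow₁ (- 1ℤ) c (b + d) (c-c c) (x+y-y b d) $
      Q-addRow₂ 1ℤ 0ℤ (- b) (0+c c) (-b+[b+d] b d) $
      Q-c≡0 (by-det (det-identity b c d) det≡1)
      where
      c-c : ∀ c → c + - 1ℤ * c ≡ 0ℤ
      c-c = solve-∀
      x+y-y : ∀ x y → x + y + - 1ℤ * y ≡ x
      x+y-y = solve-∀
      0+c : ∀ c → 0ℤ + 1ℤ * c ≡ c
      0+c = solve-∀
      -b+[b+d] : ∀ b d → - b + 1ℤ * (b + d) ≡ d
      -b+[b+d] = solve-∀
      det-identity : ∀ b c d → c * - b - (b + d) * 0ℤ ≡ 0ℤ * d - b * c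
      det-identity = solve-∀

    -- Euclid's algorithm on the first column, by row operations.
    Q-euclid₁ : ∀ k x y → y ℕ.< k → ∀ b d → SL (matℤ (+ x) b (+ y) d) → Q (matℤ (+ x) b (+ y) d)
    Q-euclid₂ : ∀ k x y → x ℕ.< k → ∀ b d → SL (matℤ (+ x) b (+ y) d) → Q (matℤ (+ x) b (+ y) d)

    Q-euclid₁ k       x zero          _          b d det≡1 = Q-c≡0 det≡1
    Q-euclid₁ (suc k) x y@(suc _) (s≤s y≤k) b d det≡1 =
      Q-addRow₁ q (+ r) (b - q * d) (pos-divMod x y) (x-y+y b (q * d)) $
      Q-euclid₂ k r y (ℕ.<-≤-trans (ℕ.m%n<n x y) y≤k) (b - q * d) d
        (by-det (trans (same-det (+ r) q (+ y) b d) (cong (λ x → x * d - b * + y) (pos-divMod x y))) det≡1)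
      where
      q : ℤ
      q = + (x ℕ./ y)
      r : ℕ
      r = x ℕ.% y
      same-det : ∀ r q y b d → r * d - (b - q * d) * y ≡ (r + q * y) * d - b * y
      same-det = solve-∀

    Q-euclid₂ k       zero          y _          b d det≡1 = Q-a≡0 det≡1
    Q-euclid₂ (suc k) x@(suc _) y (s≤s x≤k) b d det≡1 =
      Q-addRow₂ q (+ r) (d - q * b) (pos-divMod y x) (x-y+y d (q * b)) $
      Q-euclid₁ k x r (ℕ.<-≤-trans (ℕ.m%n<n y x) x≤k) b (d - q * b)
        (by-det (trans (same-det (+ x) q (+ r) b d) (cong (λ y → + x * d - b * y) (pos-divMod y x))) det≡1)
      where
      q : ℤ
      q = + (y ℕ./ x)
      r : ℕ
      r = y ℕ.% x
      same-det : ∀ x q r b d → x * (d - q * b) - b * r ≡ x * d - b * (r + q * x)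
      same-det = solve-∀

  SL₂-generated : ∀ A → detᴹ A ≡ 1ℤ mod n → Q A
  SL₂-generated (matℤ a b c d) det≡1 =
    Q-resp residues≋A (Q-euclid₁ (suc (c %ℕ n)) (a %ℕ n) (c %ℕ n) ℕ.≤-refl b d
      (≡-mod-trans (detᴹ-cong-mod residues≋A) det≡1))
    where
    residues≋A : matℤ (+ (a %ℕ n)) b (+ (c %ℕ n)) d ≋ matℤ a b c d mod n
    residues≋A = entrywise (%ℕ-≡-mod a) ≡-mod-refl (%ℕ-≡-mod c) ≡-mod-refl

-- Matrices over ℤ/N as integer matrices

toℤᴹ : ∀ {N} → Mat N → Matℤ
toℤᴹ (mat a b c d) = matℤ (+ toℕ a) (+ toℕ b) (+ toℕ c) (+ toℕ d)

+toℕ-fin : ∀ N .{{_ : NonZero N}} m → + toℕ (fin N m) ≡ + m mod N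
+toℕ-fin N m = ≡-mod-trans (≡-mod-reflexive (cong +_ (Fin.toℕ-fromℕ< _))) (%ℕ-≡-mod (+ m))

toℤᴹ-reduce : ∀ {N} M .{{_ : NonZero M}} (A : Mat N) → toℤᴹ (reduce M A) ≋ toℤᴹ A mod M
toℤᴹ-reduce M (mat a b c d) = entrywise (+toℕ-fin M (toℕ a)) (+toℕ-fin M (toℕ b)) (+toℕ-fin M (toℕ c)) (+toℕ-fin M (toℕ d))

module _ {N : ℕ} .{{_ : NonZero N}} where

  private
    +toℕ-addN : ∀ x y → + toℕ (addN N x y) ≡ + toℕ x + + toℕ y mod N
    +toℕ-addN x y = ≡-mod-trans (+toℕ-fin N _) (≡-mod-reflexive (ℤ.pos-+ (toℕ x) (toℕ y)))

    +toℕ-mulN : ∀ x y → + toℕ (mulN N x y) ≡ + toℕ x * + toℕ y mod N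
    +toℕ-mulN x y = ≡-mod-trans (+toℕ-fin N _) (≡-mod-reflexive (ℤ.pos-* (toℕ x) (toℕ y)))

    +toℕ-negN : ∀ x → + toℕ (negN N x) ≡ - + toℕ x mod N
    +toℕ-negN x = ≡-mod-trans (+toℕ-fin N _) (≡-mod-trans (≡-mod-reflexive N∸x≡-x+N) (x+kn≡x-mod (- + toℕ x) 1ℤ))
      where
      N∸x≡-x+N : + (N ℕ.∸ toℕ x) ≡ - + toℕ x + 1ℤ * + N
      N∸x≡-x+N = begin
        + (N ℕ.∸ toℕ x)       ≡⟨ ℤ.⊖-≥ (ℕ.<⇒≤ (Fin.toℕ<n x)) ⟨
        N ℤ.⊖ toℕ x           ≡⟨ ℤ.m-n≡m⊖n N (toℕ x) ⟨
        + N - + toℕ x         ≡⟨ swap (+ N) (+ toℕ x) ⟩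
        - + toℕ x + 1ℤ * + N  ∎
        where
        open ≡-Reasoning
        swap : ∀ n x → n - x ≡ - x + 1ℤ * n
        swap = solve-∀

  opaque
    unfolding _*ᴹ_

    toℤᴹ-· : ∀ (A B : Mat N) → toℤᴹ (A · B) ≋ toℤᴹ A *ᴹ toℤᴹ B mod N
    toℤᴹ-· (mat a b c d) (mat a′ b′ c′ d′) = entrywise (entry a b a′ c′) (entry a b b′ d′) (entry c d a′ c′) (entry c d b′ d′)
      where
      entry : ∀ x y z w → + toℕ (addN N (mulN N x z) (mulN N y w)) ≡ + toℕ x * + toℕ z + + toℕ y * + toℕ w mod N
      entry x y z w = ≡-mod-trans (+toℕ-addN (mulN N x z) (mulN N y w)) (+-cong-mod (+toℕ-mulN x z) (+toℕ-mulN y w))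

  toℤᴹ-I₂ : toℤᴹ (I₂ {N}) ≋ 1ᴹ mod N
  toℤᴹ-I₂ = entrywise (+toℕ-fin N 1) (+toℕ-fin N 0) (+toℕ-fin N 0) (+toℕ-fin N 1)

  toℤᴹ-det : ∀ (A : Mat N) → + toℕ (det A) ≡ detᴹ (toℤᴹ A) mod N
  toℤᴹ-det (mat a b c d) = ≡-mod-trans (+toℕ-addN (mulN N a d) (negN N (mulN N b c)))
    (+-cong-mod (+toℕ-mulN a d) (≡-mod-trans (+toℕ-negN (mulN N b c)) (neg-cong-mod (+toℕ-mulN b c))))

  toℕ-≡-mod⇒≡ : ∀ {x y : Fin N} → + toℕ x ≡ + toℕ y mod N → x ≡ y
  toℕ-≡-mod⇒≡ {x} {y} x≡y = Fin.toℕ-injective (≡-mod⇒≡ (Fin.toℕ<n x) (Fin.toℕ<n y) x≡y)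

  toℤᴹ-injective : ∀ {A B : Mat N} → toℤᴹ A ≋ toℤᴹ B mod N → A ≡ B
  toℤᴹ-injective {mat a b c d} {mat a′ b′ c′ d′} (entrywise p q r s)
    rewrite toℕ-≡-mod⇒≡ p | toℕ-≡-mod⇒≡ q | toℕ-≡-mod⇒≡ r | toℕ-≡-mod⇒≡ s = refl

  det≡1⇒SL2 : ∀ {A : Mat N} → detᴹ (toℤᴹ A) ≡ 1ℤ mod N → SL2 A
  det≡1⇒SL2 {A} det≡1 = toℕ-≡-mod⇒≡ (≡-mod-trans (toℤᴹ-det A) (≡-mod-trans det≡1 (≡-mod-sym (+toℕ-fin N 1))))

  GL2⇒det-invertible : ∀ {A : Mat N} → GL2 A → ∃[ u ] detᴹ (toℤᴹ A) * u ≡ 1ℤ mod N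
  GL2⇒det-invertible {A} (u , det*u≡1) = + toℕ u , (begin
    detᴹ (toℤᴹ A) * + toℕ u   ≈⟨ *-congʳ-mod (+ toℕ u) (toℤᴹ-det A) ⟨
    + toℕ (det A) * + toℕ u   ≈⟨ +toℕ-mulN (det A) u ⟨
    + toℕ (mulN N (det A) u)  ≡⟨ cong (λ x → + toℕ x) det*u≡1 ⟩
    + toℕ (oneN N)            ≈⟨ +toℕ-fin N 1 ⟩
    1ℤ                        ∎)
    where open SetoidReasoning (≡-mod-setoid N)

  det-invertible⇒GL2 : ∀ {A : Mat N} {u} → detᴹ (toℤᴹ A) * u ≡ 1ℤ mod N → GL2 A
  det-invertible⇒GL2 {A} {u} det*u≡1 = fin N (u %ℕ N) , toℕ-≡-mod⇒≡ (begin
    + toℕ (mulN N (det A) (fin N (u %ℕ N)))   ≈⟨ +toℕ-mulN (det A) _ ⟩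
    + toℕ (det A) * + toℕ (fin N (u %ℕ N))    ≈⟨ *-cong-mod (toℤᴹ-det A) (≡-mod-trans (+toℕ-fin N _) (%ℕ-≡-mod u)) ⟩
    detᴹ (toℤᴹ A) * u                          ≈⟨ det*u≡1 ⟩
    1ℤ                                         ≈⟨ +toℕ-fin N 1 ⟨
    + toℕ (oneN N)                             ∎)
    where open SetoidReasoning (≡-mod-setoid N)

  pow : Mat N → ℕ → Mat N
  pow A zero    = I₂
  pow A (suc k) = A · pow A k

  toℤᴹ-pow : ∀ (A : Mat N) k → toℤᴹ (pow A k) ≋ toℤᴹ A ^ᴹ k mod N
  toℤᴹ-pow A zero    = toℤᴹ-I₂
  toℤᴹ-pow A (suc k) = ≋-mod-trans (toℤᴹ-· A (pow A k)) (*ᴹ-cong-mod ≋-mod-refl (toℤᴹ-pow A k))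

  ·-cancelˡ-inverse : ∀ (B B′ A : Mat N) → B · B′ ≡ I₂ → B · (B′ · A) ≡ A
  ·-cancelˡ-inverse B B′ A BB′≡I = toℤᴹ-injective (begin
    toℤᴹ (B · (B′ · A))                    ≈⟨ toℤᴹ-· B (B′ · A) ⟩
    toℤᴹ B *ᴹ toℤᴹ (B′ · A)                ≈⟨ *ᴹ-cong-mod ≋-mod-refl (toℤᴹ-· B′ A) ⟩
    toℤᴹ B *ᴹ (toℤᴹ B′ *ᴹ toℤᴹ A)          ≡⟨ *ᴹ-assoc (toℤᴹ B) (toℤᴹ B′) (toℤᴹ A) ⟨
    toℤᴹ B *ᴹ toℤᴹ B′ *ᴹ toℤᴹ A            ≈⟨ *ᴹ-cong-mod (toℤᴹ-· B B′) ≋-mod-refl ⟨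
    toℤᴹ (B · B′) *ᴹ toℤᴹ A                ≡⟨ cong (λ X → toℤᴹ X *ᴹ toℤᴹ A) BB′≡I ⟩
    toℤᴹ I₂ *ᴹ toℤᴹ A                      ≈⟨ *ᴹ-cong-mod toℤᴹ-I₂ ≋-mod-refl ⟩
    1ᴹ *ᴹ toℤᴹ A                           ≡⟨ *ᴹ-identityˡ (toℤᴹ A) ⟩
    toℤᴹ A                                 ∎)
    where open SetoidReasoning (≋-mod-setoid N)

  inverse⇒≋-inverse : ∀ (A A′ : Mat N) → A · A′ ≡ I₂ → toℤᴹ A *ᴹ toℤᴹ A′ ≋ 1ᴹ mod N
  inverse⇒≋-inverse A A′ AA′≡I =
    ≋-mod-trans (≋-mod-sym (toℤᴹ-· A A′)) (≋-mod-trans (≋-mod-reflexive (cong toℤᴹ AA′≡I)) toℤᴹ-I₂)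

  toℤᴹ-commutator : ∀ (g h g′ h′ : Mat N) →
    toℤᴹ (((g · h) · g′) · h′) ≋ toℤᴹ g *ᴹ toℤᴹ h *ᴹ toℤᴹ g′ *ᴹ toℤᴹ h′ mod N
  toℤᴹ-commutator g h g′ h′ =
    ≋-mod-trans (toℤᴹ-· ((g · h) · g′) h′) (*ᴹ-cong-mod
      (≋-mod-trans (toℤᴹ-· (g · h) g′) (*ᴹ-cong-mod (toℤᴹ-· g h) ≋-mod-refl)) ≋-mod-refl)

module _ {N N₁ N₂ : ℕ} .{{_ : NonZero N}} .{{_ : NonZero N₁}} .{{_ : NonZero N₂}}
  (N≡N₁N₂ : N ≡ N₁ ℕ.* N₂)
  (N₁-small : ∀ p → Prime p → p ℕ.∣ N₁ → p ℕ.< 5)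
  (N₂-large : ∀ p → Prime p → p ℕ.∣ N₂ → 5 ℕ.≤ p)
  (G : Mat N → Set) (G-subgroup : IsSubgroup G)
  (G↠GL₂[N₁] : ∀ (M : Mat N₁) → GL2 M → Σ (Mat N) λ g → G g × reduce N₁ g ≡ M)
  (G↠GL₂[N₂] : ∀ (M : Mat N₂) → GL2 M → Σ (Mat N) λ g → G g × reduce N₂ g ≡ M) where

  open IsSubgroup G-subgroup

  private
    N₁∣N : N₁ ℕ.∣ N
    N₁∣N = subst (N₁ ℕ.∣_) (sym N≡N₁N₂) (ℕ.m∣m*n N₂)

    N₂∣N : N₂ ℕ.∣ N
    N₂∣N = subst (N₂ ℕ.∣_) (sym N≡N₁N₂) (ℕ.n∣m*n N₁)

    ≋-mod-N₁N₂ : ∀ {A B} → A ≋ B mod N₁ → A ≋ B mod N₂ → A ≋ B mod N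
    ≋-mod-N₁N₂ {A} {B} A≋B A≋B′ = subst (A ≋ B mod_) (sym N≡N₁N₂)
      (≋-mod-coprime-* (separated-prime-factors⇒coprime 5 N₁-small N₂-large) A≋B A≋B′)

  G-pow : ∀ {A} k → G A → G (pow A k)
  G-pow zero    _   = has-I
  G-pow (suc k) A∈G = ·-closed _ _ A∈G (G-pow k A∈G)

  record Lift (X : Matℤ) : Set where
    constructor lift
    field
      w : Mat N
      w∈G : G w
      w≋1 : toℤᴹ w ≋ 1ᴹ mod N₁
      w≋X : toℤᴹ w ≋ X mod N₂

  lift-resp : ∀ {X Y} → X ≋ Y mod N₂ → Lift X → Lift Y
  lift-resp X≋Y (lift w w∈G w≋1 w≋X) = lift w w∈G w≋1 (≋-mod-trans w≋X X≋Y)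

  lift-1ᴹ : Lift 1ᴹ
  lift-1ᴹ = lift I₂ has-I (≋-mod-∣ N₁∣N toℤᴹ-I₂) (≋-mod-∣ N₂∣N toℤᴹ-I₂)

  lift-*ᴹ : ∀ {X Y} → Lift X → Lift Y → Lift (X *ᴹ Y)
  lift-*ᴹ (lift w w∈G w≋1 w≋X) (lift w′ w′∈G w′≋1 w′≋Y) = lift (w · w′) (·-closed w w′ w∈G w′∈G)
    (≋-mod-trans (≋-mod-∣ N₁∣N (toℤᴹ-· w w′)) (≋-mod-trans (*ᴹ-cong-mod w≋1 w′≋1) (≋-mod-reflexive (*ᴹ-identityˡ 1ᴹ))))
    (≋-mod-trans (≋-mod-∣ N₂∣N (toℤᴹ-· w w′)) (*ᴹ-cong-mod w≋X w′≋Y))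

  -- A power g^(24ᵉ j) of g kills it modulo N₁, and for 24ᵉ j ≡ 1 (mod N₂) it
  -- is still congruent to E modulo N₂.
  lift-power : ∀ {g E} → G g → toℤᴹ g ≋ E mod N₂ → (∀ k → + k ≡ 1ℤ mod N₂ → E ^ᴹ k ≋ E mod N₂) → Lift E
  lift-power {g} {E} g∈G g≋E E-stable = lift (pow g k) (G-pow k g∈G) trivial-mod-N₁ E-mod-N₂
    where
    det-invertible : ∃[ u ] detᴹ (toℤᴹ g) * u ≡ 1ℤ mod N
    det-invertible = GL2⇒det-invertible {A = g} (⊆GL g g∈G)
    exponent : ∃[ e ] toℤᴹ g ^ᴹ (24 ^ e) ≋ 1ᴹ mod N₁
    exponent = exponent-24 N₁-small {toℤᴹ g} {proj₁ det-invertible} (≡-mod-∣ N₁∣N (proj₂ det-invertible))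
    e : ℕ
    e = proj₁ exponent
    inverse : ∃[ j ] + (24 ^ e) * j ≡ 1ℤ mod N₂
    inverse = inverse-mod (separated-prime-factors⇒coprime 5 (λ p p-prime → prime∣24^⇒<5 e p-prime) N₂-large)
    j : ℕ
    j = proj₁ inverse %ℕ N₂
    k : ℕ
    k = 24 ^ e ℕ.* j
    k≡1 : + k ≡ 1ℤ mod N₂
    k≡1 = ≡-mod-trans (≡-mod-reflexive (ℤ.pos-* (24 ^ e) j))
      (≡-mod-trans (*-congˡ-mod (+ (24 ^ e)) (%ℕ-≡-mod (proj₁ inverse))) (proj₂ inverse))
    trivial-mod-N₁ : toℤᴹ (pow g k) ≋ 1ᴹ mod N₁
    trivial-mod-N₁ = ≋-mod-trans (≋-mod-∣ N₁∣N (toℤᴹ-pow g k))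
      (≋-mod-trans (≋-mod-reflexive (^ᴹ-* (toℤᴹ g) (24 ^ e) j)) (≋1ᴹ⇒^ᴹ≋1ᴹ j (proj₂ exponent)))
    E-mod-N₂ : toℤᴹ (pow g k) ≋ E mod N₂
    E-mod-N₂ = ≋-mod-trans (≋-mod-∣ N₂∣N (toℤᴹ-pow g k)) (≋-mod-trans (^ᴹ-cong-mod k g≋E) (E-stable k k≡1))

  lift-stable : ∀ {E} (Ē : Mat N₂) → GL2 Ē → toℤᴹ Ē ≋ E mod N₂ →
    (∀ k → + k ≡ 1ℤ mod N₂ → E ^ᴹ k ≋ E mod N₂) → Lift E
  lift-stable Ē Ē∈GL Ē≋E E-stable with G↠GL₂[N₂] Ē Ē∈GL
  ... | g , g∈G , reduce-g≡Ē = lift-power g∈G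
    (≋-mod-trans (≋-mod-sym (toℤᴹ-reduce N₂ g)) (≋-mod-trans (≋-mod-reflexive (cong toℤᴹ reduce-g≡Ē)) Ē≋E)) E-stable

  private
    E₁₂^k≋E₁₂ : ∀ k → + k ≡ 1ℤ mod N₂ → E₁₂ 1ℤ ^ᴹ k ≋ E₁₂ 1ℤ mod N₂
    E₁₂^k≋E₁₂ k k≡1 = ≋-mod-trans (≋-mod-reflexive (E₁₂-^ᴹ k)) (entrywise ≡-mod-refl k≡1 ≡-mod-refl ≡-mod-refl)

    E₂₁^k≋E₂₁ : ∀ k → + k ≡ 1ℤ mod N₂ → E₂₁ 1ℤ ^ᴹ k ≋ E₂₁ 1ℤ mod N₂
    E₂₁^k≋E₂₁ k k≡1 = ≋-mod-trans (≋-mod-reflexive (E₂₁-^ᴹ k)) (entrywise ≡-mod-refl ≡-mod-refl k≡1 ≡-mod-refl)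

    unimodular⇒GL2 : ∀ {Ē : Mat N₂} {E} → toℤᴹ Ē ≋ E mod N₂ → detᴹ E ≡ 1ℤ → GL2 Ē
    unimodular⇒GL2 {Ē} {E} Ē≋E detE≡1 = det-invertible⇒GL2 {A = Ē} {u = 1ℤ}
      (≡-mod-trans (≡-mod-reflexive (ℤ.*-identityʳ _)) (≡-mod-trans (detᴹ-cong-mod Ē≋E) (≡-mod-reflexive detE≡1)))

    Ē₁₂ Ē₂₁ : Mat N₂
    Ē₁₂ = mat (oneN N₂) (oneN N₂) (zeroN N₂) (oneN N₂)
    Ē₂₁ = mat (oneN N₂) (zeroN N₂) (oneN N₂) (oneN N₂)

    Ē₁₂≋E₁₂ : toℤᴹ Ē₁₂ ≋ E₁₂ 1ℤ mod N₂
    Ē₁₂≋E₁₂ = entrywise (+toℕ-fin N₂ 1) (+toℕ-fin N₂ 1) (+toℕ-fin N₂ 0) (+toℕ-fin N₂ 1)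

    Ē₂₁≋E₂₁ : toℤᴹ Ē₂₁ ≋ E₂₁ 1ℤ mod N₂
    Ē₂₁≋E₂₁ = entrywise (+toℕ-fin N₂ 1) (+toℕ-fin N₂ 0) (+toℕ-fin N₂ 1) (+toℕ-fin N₂ 1)

  lift-E₁₂ : Lift (E₁₂ 1ℤ)
  lift-E₁₂ = lift-stable Ē₁₂ (unimodular⇒GL2 Ē₁₂≋E₁₂ refl) Ē₁₂≋E₁₂ E₁₂^k≋E₁₂

  lift-E₂₁ : Lift (E₂₁ 1ℤ)
  lift-E₂₁ = lift-stable Ē₂₁ (unimodular⇒GL2 Ē₂₁≋E₂₁ refl) Ē₂₁≋E₂₁ E₂₁^k≋E₂₁

  G-kernel : ∀ {z} → toℤᴹ z ≋ 1ᴹ mod N₁ → detᴹ (toℤᴹ z) ≡ 1ℤ mod N₂ → G z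
  G-kernel {z} z≋1 det≡1 = subst G (toℤᴹ-injective (≋-mod-N₁N₂ (≋-mod-trans w≋1 (≋-mod-sym z≋1)) w≋z)) w∈G
    where
    open SL₂-generation N₂ Lift lift-resp lift-1ᴹ (lift-*ᴹ lift-E₁₂) (lift-*ᴹ lift-E₂₁)
    open Lift (SL₂-generated (toℤᴹ z) det≡1) renaming (w≋X to w≋z)

  -- c = d · (d⁻¹ · c), and d⁻¹ · c lies in the kernel of reduction mod N₁.
  G-resp-≋-mod-N₁ : ∀ {c d} → G d → toℤᴹ c ≋ toℤᴹ d mod N₁ → detᴹ (toℤᴹ c) ≡ detᴹ (toℤᴹ d) mod N₂ → G c
  G-resp-≋-mod-N₁ {c} {d} d∈G c≋d detc≡detd with inv-closed d d∈G
  ... | d′ , d′∈G , dd′≡I = subst G (·-cancelˡ-inverse d d′ c dd′≡I) (·-closed d (d′ · c) d∈G (G-kernel {d′ · c} z≋1 detz≡1))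
    where
    D′D≋1 : toℤᴹ d′ *ᴹ toℤᴹ d ≋ 1ᴹ mod N
    D′D≋1 = inverseʳ⇒inverseˡ-mod (inverse⇒≋-inverse d d′ dd′≡I)
    z≋1 : toℤᴹ (d′ · c) ≋ 1ᴹ mod N₁
    z≋1 = ≋-mod-trans (≋-mod-∣ N₁∣N (toℤᴹ-· d′ c)) (≋-mod-trans (*ᴹ-cong-mod ≋-mod-refl c≋d) (≋-mod-∣ N₁∣N D′D≋1))
    detz≡1 : detᴹ (toℤᴹ (d′ · c)) ≡ 1ℤ mod N₂
    detz≡1 = ≡-mod-trans (≡-mod-∣ N₂∣N (detᴹ-cong-mod (toℤᴹ-· d′ c)))
      (≡-mod-trans (≡-mod-reflexive (detᴹ-*ᴹ (toℤᴹ d′) (toℤᴹ c)))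
      (≡-mod-trans (*-congˡ-mod (detᴹ (toℤᴹ d′)) detc≡detd)
      (≡-mod-trans (≡-mod-reflexive (sym (detᴹ-*ᴹ (toℤᴹ d′) (toℤᴹ d)))) (≡-mod-∣ N₂∣N (detᴹ-cong-mod D′D≋1)))))

  record InverseLift (g g′ : Mat N) : Set where
    field
      a a′ : Mat N
      a∈G : G a
      a′∈G : G a′
      aa′≡I : a · a′ ≡ I₂
      a≋g : toℤᴹ a ≋ toℤᴹ g mod N₁
      a′≋g′ : toℤᴹ a′ ≋ toℤᴹ g′ mod N₁

  inverse-lift : ∀ {g g′ : Mat N} → g · g′ ≡ I₂ → InverseLift g g′
  inverse-lift {g} {g′} gg′≡I = from-lift (G↠GL₂[N₁] (reduce N₁ g) (det-invertible⇒GL2 {A = reduce N₁ g} det-invertible))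
    where
    det-invertible : detᴹ (toℤᴹ (reduce N₁ g)) * detᴹ (toℤᴹ g′) ≡ 1ℤ mod N₁
    det-invertible = ≡-mod-trans (*-congʳ-mod (detᴹ (toℤᴹ g′)) (detᴹ-cong-mod (toℤᴹ-reduce N₁ g)))
      (≡-mod-∣ N₁∣N (detᴹ-inverse-mod (inverse⇒≋-inverse g g′ gg′≡I)))
    from-lift : Σ (Mat N) (λ a → G a × reduce N₁ a ≡ reduce N₁ g) → InverseLift g g′
    from-lift (a , a∈G , reduce-a≡reduce-g) = from-inverse (inv-closed a a∈G)
      where
      a≋g : toℤᴹ a ≋ toℤᴹ g mod N₁
      a≋g = ≋-mod-trans (≋-mod-sym (toℤᴹ-reduce N₁ a))
        (≋-mod-trans (≋-mod-reflexive (cong toℤᴹ reduce-a≡reduce-g)) (toℤᴹ-reduce N₁ g))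
      from-inverse : Σ (Mat N) (λ a′ → G a′ × a · a′ ≡ I₂) → InverseLift g g′
      from-inverse (a′ , a′∈G , aa′≡I) = record
        { a = a ; a′ = a′ ; a∈G = a∈G ; a′∈G = a′∈G ; aa′≡I = aa′≡I ; a≋g = a≋g
        ; a′≋g′ = inverse-unique-mod a≋g (≋-mod-∣ N₁∣N (inverse⇒≋-inverse a a′ aa′≡I)) (≋-mod-∣ N₁∣N (inverse⇒≋-inverse g g′ gg′≡I))
        }

  -- A commutator [g, h] is congruent mod N₁ to the commutator in G of lifts of g and h.
  G-commutator : ∀ {g g′ h h′ : Mat N} → g · g′ ≡ I₂ → h · h′ ≡ I₂ → G (((g · h) · g′) · h′)
  G-commutator {g} {g′} {h} {h′} gg′≡I hh′≡I =
    G-resp-≋-mod-N₁ d∈G c≋d (≡-mod-∣ N₂∣N (≡-mod-trans (det≡1 g g′ h h′ gg′≡I hh′≡I) (≡-mod-sym (det≡1 A.a A.a′ B.a B.a′ A.aa′≡I B.aa′≡I))))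
    where
    module A = InverseLift (inverse-lift {g} {g′} gg′≡I)
    module B = InverseLift (inverse-lift {h} {h′} hh′≡I)
    d∈G : G (((A.a · B.a) · A.a′) · B.a′)
    d∈G = ·-closed _ B.a′ (·-closed _ A.a′ (·-closed A.a B.a A.a∈G B.a∈G) A.a′∈G) B.a′∈G
    c≋d : toℤᴹ (((g · h) · g′) · h′) ≋ toℤᴹ (((A.a · B.a) · A.a′) · B.a′) mod N₁
    c≋d = ≋-mod-trans (≋-mod-∣ N₁∣N (toℤᴹ-commutator g h g′ h′)) (≋-mod-trans
      (≋-mod-sym (*ᴹ-cong-mod (*ᴹ-cong-mod (*ᴹ-cong-mod A.a≋g B.a≋g) A.a′≋g′) B.a′≋g′))
      (≋-mod-sym (≋-mod-∣ N₁∣N (toℤᴹ-commutator A.a B.a A.a′ B.a′))))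
    det≡1 : ∀ (x x′ y y′ : Mat N) → x · x′ ≡ I₂ → y · y′ ≡ I₂ → detᴹ (toℤᴹ (((x · y) · x′) · y′)) ≡ 1ℤ mod N
    det≡1 x x′ y y′ xx′≡I yy′≡I = ≡-mod-trans (detᴹ-cong-mod (toℤᴹ-commutator x y x′ y′))
      (detᴹ-commutator (inverse⇒≋-inverse x x′ xx′≡I) (inverse⇒≋-inverse y y′ yy′≡I))

  Comm⊆G : ∀ {M : Mat N} → Comm M → G M
  Comm⊆G (comm g g′ h h′ gg′≡I hh′≡I) = G-commutator {g} {g′} {h} {h′} gg′≡I hh′≡I
  Comm⊆G comm-I                         = has-I
  Comm⊆G (comm-· M M′ M∈C M′∈C)         = ·-closed M M′ (Comm⊆G M∈C) (Comm⊆G M′∈C)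

  -- M = g · (g⁻¹ · M) with det g = det M, and g⁻¹ · M ∈ H ∩ SL₂ ⊆ [GL₂, GL₂] ⊆ G.
  ∩SL2⊆Comm⇒⊆G : ∀ {H : Mat N → Set} → IsSubgroup H → (∀ M → G M → H M) → (∀ M → H M × SL2 M → Comm M) →
    (∀ (u : Fin N) → IsUnit N u → Σ (Mat N) λ g → G g × det g ≡ u) → ∀ M → H M → G M
  ∩SL2⊆Comm⇒⊆G {H} H-subgroup G⊆H H∩SL2⊆Comm det-surj M M∈H
    with det-surj (det M) (IsSubgroup.⊆GL H-subgroup M M∈H)
  ... | g , g∈G , detg≡detM
    with inv-closed g g∈G
  ... | g′ , g′∈G , gg′≡I =
    subst G (·-cancelˡ-inverse g g′ M gg′≡I) (·-closed g (g′ · M) g∈G (Comm⊆G (H∩SL2⊆Comm (g′ · M) (g′M∈H , det≡1⇒SL2 {A = g′ · M} detg′M≡1))))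
    where
    g′M∈H : H (g′ · M)
    g′M∈H = IsSubgroup.·-closed H-subgroup g′ M (G⊆H g′ g′∈G) M∈H
    detg′M≡1 : detᴹ (toℤᴹ (g′ · M)) ≡ 1ℤ mod N
    detg′M≡1 = begin
      detᴹ (toℤᴹ (g′ · M))                ≈⟨ detᴹ-cong-mod (toℤᴹ-· g′ M) ⟩
      detᴹ (toℤᴹ g′ *ᴹ toℤᴹ M)            ≡⟨ detᴹ-*ᴹ (toℤᴹ g′) (toℤᴹ M) ⟩
      detᴹ (toℤᴹ g′) * detᴹ (toℤᴹ M)      ≈⟨ *-congˡ-mod (detᴹ (toℤᴹ g′)) (toℤᴹ-det M) ⟨
      detᴹ (toℤᴹ g′) * + toℕ (det M)      ≡⟨ cong (λ x → detᴹ (toℤᴹ g′) * + toℕ x) detg≡detM ⟨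
      detᴹ (toℤᴹ g′) * + toℕ (det g)      ≈⟨ *-congˡ-mod (detᴹ (toℤᴹ g′)) (toℤᴹ-det g) ⟩
      detᴹ (toℤᴹ g′) * detᴹ (toℤᴹ g)      ≡⟨ ℤ.*-comm (detᴹ (toℤᴹ g′)) (detᴹ (toℤᴹ g)) ⟩
      detᴹ (toℤᴹ g) * detᴹ (toℤᴹ g′)      ≈⟨ detᴹ-inverse-mod (inverse⇒≋-inverse g g′ gg′≡I) ⟩
      1ℤ                                  ∎
      where open SetoidReasoning (≡-mod-setoid N)

lemma11 : (N N₁ N₂ : ℕ) .{{_ : NonZero N}} .{{_ : NonZero N₁}} .{{_ : NonZero N₂}} →
    1 ℕ.< N →
    Σ ℕ (λ p → Prime p × 5 ℕ.≤ p × p ℕ.∣ N) →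
    Σ ℕ (λ p → Prime p × p ℕ.< 5 × p ℕ.∣ N) →
    N ≡ N₁ ℕ.* N₂ →
    (∀ p → Prime p → p ℕ.∣ N₁ → p ℕ.< 5) →
    (∀ p → Prime p → p ℕ.∣ N₂ → 5 ℕ.≤ p) →
    (Ga Gb : Mat N → Set) →
    IsSubgroup {N} Ga →
    (∀ M → Ga M × SL2 {N} M → Comm {N} M) →
    (∀ M → Comm {N} M → Ga M × SL2 {N} M) →
    IsSubgroup {N} Gb →
    (∀ M → Gb M → Ga M) →
    (∀ (M : Mat N₁) → GL2 {N₁} M → Σ (Mat N) λ g → Gb g × reduce N₁ g ≡ M) →
    (∀ (M : Mat N₂) → GL2 {N₂} M → Σ (Mat N) λ g → Gb g × reduce N₂ g ≡ M) →
    (∀ (u : Fin N) → IsUnit N u → Σ (Mat N) λ g → Gb g × det g ≡ u) →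
    ∀ M → (Gb M → Ga M) × (Ga M → Gb M)
lemma11 N N₁ N₂ _ _ _ N≡N₁N₂ N₁-small N₂-large Ga Gb Ga-subgroup Ga∩SL2⊆Comm _
        Gb-subgroup Gb⊆Ga Gb↠GL₂[N₁] Gb↠GL₂[N₂] det-surj M =
  Gb⊆Ga M ,
  ∩SL2⊆Comm⇒⊆G N≡N₁N₂ N₁-small N₂-large Gb Gb-subgroup Gb↠GL₂[N₁] Gb↠GL₂[N₂]
    Ga-subgroup Gb⊆Ga Ga∩SL2⊆Comm det-surj M
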